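{- Let $m\ge1$. Two binary trees $T,T'$ with $m$ nodes are LR-equivalent if and only if $\psi(T)$ and $\psi(T')$ are isomorphic as bicolored trees; thus LR-classes of binary trees with $m$ nodes are parametrized by (isomorphism classes of) bipartite bicolored free trees with $m+1$ vertices.
   Context: Binary trees are (incomplete) binary trees. For a node $v$ that is the root or the right child of its parent and has a right child $w$, $L_v(T)$ exchanges the left subtree of $v$ with the left subtree of $w$. For a node $v$ that is the root or the left child of its parent and has a left child $w$, $R_v(T)$ exchanges the right subtree of $v$ with the right subtree of $w$. LR-equivalence is the equivalence relation generated by $T\sim L_v(T)$ and $T\sim R_v(T)$. Encoding $\psi$: number the nodes of $T$ in infix order $1,\dots,m$; let $L(T)$ (resp. $R(T)$) be the set partition of $\{1,\dots,m\}$ into maximal sets of nodes connected by left edges (resp. right edges). $\psi(T)$ is the free (unrooted, unordered) tree whose vertices are the blocks of $L(T)$ (colored white) and of $R(T)$ (colored black), two blocks being adjacent iff they intersect. A bipartite bicolored free tree is a free tree with vertices colored black and white such that adjacent vertices have different colors; isomorphisms must preserve colors. -}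

module Defs where

open import Level using (0ℓ)
open import Data.Nat using (ℕ; zero; suc; _+_)
open import Data.Bool using (Bool; true; false)
open import Data.Fin using (Fin)
open import Data.List using (List; []; _∷_)
open import Data.List.Relation.Unary.Unique.Propositional using (Unique)
open import Data.Product using (Σ; ∃; _×_; _,_)
open import Data.Sum using (_⊎_; inj₁; inj₂)
open import Data.Empty using (⊥)
open import Data.Unit using (⊤)
open import Relation.Nullary using (¬_)
open import Relation.Binary using (Setoid; Rel)
open import Relation.Binary.PropositionalEquality using (_≡_; _≢_)
import Relation.Binary.PropositionalEquality as P
open import Relation.Binary.Construct.Closure.Equivalence using (EqClosure)
import Relation.Binary.Construct.Closure.Equivalence as EqC
open import Relation.Binary.Construct.Closure.ReflexiveTransitive using (Star)
open import Data.Sum.Relation.Binary.Pointwise using (⊎-setoid)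
open import Function.Bundles using (Inverse; _⇔_)

data BT : Set where
  leaf : BT
  node : BT → BT → BT

size : BT → ℕ
size leaf       = 0
size (node l r) = suc (size l + size r)

-- The moves L_v and R_v.
-- A position in the tree is remembered together with its "side":
-- the root, a left child, or a right child of its parent.

data Side : Set where
  root lft rgt : Side

data RootOrRight : Side → Set where
  isRoot  : RootOrRight root
  isRight : RootOrRight rgt

data RootOrLeft : Side → Set where
  isRoot  : RootOrLeft root
  isLeft  : RootOrLeft lft

-- Move s T T' : T' is obtained from the subtree T (sitting at side s)
-- by applying L_v or R_v at some node v of T.
data Move : Side → BT → BT → Set where
  L-here : ∀ {s A B C} → RootOrRight s →
           Move s (node A (node B C)) (node B (node A C))
  R-here : ∀ {s A B C} → RootOrLeft s →
           Move s (node (node A B) C) (node (node A C) B)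
  go-left  : ∀ {s A A' B} → Move lft A A' → Move s (node A B) (node A' B)
  go-right : ∀ {s A B B'} → Move rgt B B' → Move s (node A B) (node A B')

LRStep : Rel BT 0ℓ
LRStep = Move root

LREquiv : Rel BT 0ℓ
LREquiv = EqClosure LRStep

data Node : BT → Set where
  here : ∀ {l r} → Node (node l r)
  inL  : ∀ {l r} → Node l → Node (node l r)
  inR  : ∀ {l r} → Node r → Node (node l r)

data LeftEdge : {T : BT} → Node T → Node T → Set where
  le-here : ∀ {a b r} → LeftEdge {node (node a b) r} here (inL here)
  le-L    : ∀ {l r} {p q : Node l} → LeftEdge p q → LeftEdge {node l r} (inL p) (inL q)
  le-R    : ∀ {l r} {p q : Node r} → LeftEdge p q → LeftEdge {node l r} (inR p) (inR q)

data RightEdge : {T : BT} → Node T → Node T → Set where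
  re-here : ∀ {l a b} → RightEdge {node l (node a b)} here (inR here)
  re-L    : ∀ {l r} {p q : Node l} → RightEdge p q → RightEdge {node l r} (inL p) (inL q)
  re-R    : ∀ {l r} {p q : Node r} → RightEdge p q → RightEdge {node l r} (inR p) (inR q)

-- Blocks of L(T) = classes of the setoid LBlocks T (similarly R).
LBlocks : BT → Setoid 0ℓ 0ℓ
LBlocks T = EqC.setoid (LeftEdge {T})

RBlocks : BT → Setoid 0ℓ 0ℓ
RBlocks T = EqC.setoid (RightEdge {T})

data Color : Set where
  white black : Color

record BGraph : Set₁ where
  field
    V     : Setoid 0ℓ 0ℓ
    color : Setoid.Carrier V → Color
    Adj   : Setoid.Carrier V → Setoid.Carrier V → Set

open BGraph

record _≅_ (G H : BGraph) : Set where
  field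
    iso       : Inverse (V G) (V H)
    pres-col  : ∀ x → color H (Inverse.to iso x) ≡ color G x
    pres-adj  : ∀ x y → Adj G x y ⇔ Adj H (Inverse.to iso x) (Inverse.to iso y)

-- The encoding ψ(T): vertices are the blocks of L(T) (white) and of
-- R(T) (black); a white block and a black block are adjacent iff they
-- intersect.  A block is represented by any of its nodes (its class).

ψ-col : {T : BT} → Node T ⊎ Node T → Color
ψ-col (inj₁ _) = white
ψ-col (inj₂ _) = black

ψ-adj : {T : BT} → Node T ⊎ Node T → Node T ⊎ Node T → Set
ψ-adj {T} (inj₁ i) (inj₂ j) = ∃ λ k → EqClosure (LeftEdge {T}) i k × EqClosure (RightEdge {T}) j k
ψ-adj {T} (inj₂ j) (inj₁ i) = ∃ λ k → EqClosure (LeftEdge {T}) i k × EqClosure (RightEdge {T}) j k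
ψ-adj (inj₁ _) (inj₁ _) = ⊥
ψ-adj (inj₂ _) (inj₂ _) = ⊥

ψ : BT → BGraph
ψ T = record
  { V     = ⊎-setoid (LBlocks T) (RBlocks T)
  ; color = ψ-col
  ; Adj   = ψ-adj
  }

Consecutive : ∀ {n} → (Fin n → Fin n → Bool) → List (Fin n) → Set
Consecutive E []           = ⊤
Consecutive E (x ∷ [])     = ⊤
Consecutive E (x ∷ y ∷ xs) = E x y ≡ true × Consecutive E (y ∷ xs)

last : ∀ {n} → Fin n → List (Fin n) → Fin n
last x []       = x
last x (y ∷ ys) = last y ys

IsCycle : ∀ {n} → (Fin n → Fin n → Bool) → List (Fin n) → Set
IsCycle E []               = ⊥
IsCycle E (_ ∷ [])         = ⊥
IsCycle E (_ ∷ _ ∷ [])     = ⊥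
IsCycle E (x ∷ y ∷ z ∷ zs) =
  Unique (x ∷ y ∷ z ∷ zs) × Consecutive E (x ∷ y ∷ z ∷ zs) × E (last z zs) x ≡ true

record BicFreeTree (n : ℕ) : Set where
  field
    edge      : Fin n → Fin n → Bool
    col       : Fin n → Color
    sym       : ∀ x y → edge x y ≡ edge y x
    irrefl    : ∀ x → edge x x ≡ false
    connected : ∀ x y → Star (λ a b → edge a b ≡ true) x y
    acyclic   : ∀ cs → ¬ IsCycle edge cs
    bipartite : ∀ x y → edge x y ≡ true → col x ≢ col y

toBGraph : ∀ {n} → BicFreeTree n → BGraph
toBGraph {n} F = record
  { V     = P.setoid (Fin n)
  ; color = BicFreeTree.col F
  ; Adj   = λ x y → BicFreeTree.edge F x y ≡ true
  }

{-# OPTIONS --safe #-}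
-- Read ψ(T) as a plane tree: root it at the left block of the root of T and order the blocks meeting
-- a block along its branch. This identifies binary trees with m nodes and plane trees with m + 1
-- vertices, and the moves become operations on plane trees: an L-move at the root reroots the tree at the first
-- grandchild of its root, every other move exchanges two neighbouring subtrees of a vertex. Neither
-- changes the underlying bicoloured free tree, which is one direction. Conversely, given an isomorphism
-- of the free trees, the vertex sent to the root is white, hence at even depth, and rerooting lifts it
-- two levels at a time until the isomorphism fixes the root; an isomorphism of rooted trees is then a
-- composite of subtree exchanges, by induction on the forest below the root. Finally, plane trees and
-- bicoloured free trees on m + 1 vertices both arise from a single vertex by attaching leaves, so each
-- free tree is the tree of blocks of some binary tree with m nodes.
module Submission where

open import Defs
open import Data.Bool using (Bool; true; false)
import Data.Bool as Bool
open import Data.Empty using (⊥; ⊥-elim)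
open import Data.Unit using (⊤; tt)
open import Data.Nat using (ℕ; zero; suc; _+_; _≤_; _≤?_; s≤s; s≤s⁻¹)
open import Data.Nat.Properties
  using (+-comm; +-suc; +-identityʳ; suc-injective; 1+n≢0; ≤-refl; ≤-trans; ≰⇒>; n≮n; n≤1+n)
open import Data.Product using (Σ; ∃; _×_; _,_; proj₁; proj₂)
open import Data.Sum using (_⊎_; inj₁; inj₂)
import Data.Sum as Sum
import Data.Sum.Relation.Binary.Pointwise as Pointwise
open import Data.List using (List; []; _∷_; map; length; lookup)
open import Data.List.Relation.Unary.Any using (here; there)
open import Data.List.Relation.Unary.All using (All; []; _∷_)
import Data.List.Relation.Unary.All as All
open import Data.List.Relation.Unary.All.Properties using (¬Any⇒All¬)
open import Data.List.Relation.Unary.AllPairs using ([]; _∷_)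
open import Data.List.Relation.Unary.Unique.Propositional using (Unique)
import Data.List.Relation.Unary.Unique.Propositional.Properties as Unique
open import Data.List.Membership.Propositional using (_∈_; _∉_)
open import Data.List.Membership.Propositional.Properties using (∈-lookup)
open import Data.Fin using (Fin; zero; suc; _<_; punchIn; punchOut)
open import Data.Fin.Properties
  using (_≟_; pigeonhole; any?; punchIn-injective; punchInᵢ≢i; punchIn-punchOut; punchOut-punchIn;
         punchOut-cong)
open import Relation.Nullary using (¬_; Dec; yes; no; does; ¬?)
open import Relation.Nullary.Decidable using (dec-true; _×-dec_)
open import Relation.Binary using (Setoid)
open import Relation.Binary.PropositionalEquality
  using (_≡_; _≢_; refl; sym; trans; cong; cong₂; subst; subst₂; module ≡-Reasoning)
import Relation.Binary.PropositionalEquality as P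
open import Relation.Binary.Construct.Closure.ReflexiveTransitive using (Star; ε; _◅_; _◅◅_)
import Relation.Binary.Construct.Closure.ReflexiveTransitive as Star
open import Relation.Binary.Construct.Closure.Symmetric using (fwd; bwd)
open import Relation.Binary.Construct.Closure.Equivalence using (EqClosure)
import Relation.Binary.Construct.Closure.Equivalence as EqClosure
open import Function.Bundles using (Inverse; Equivalence; _⇔_; mk⇔)
import Function.Construct.Composition as Compose
import Function.Construct.Symmetry as Symmetry

opposite : Color → Color
opposite white = black
opposite black = white

opposite-involutive : ∀ c → opposite (opposite c) ≡ c
opposite-involutive white = refl
opposite-involutive black = refl

opposite-injective : ∀ {c d} → opposite c ≡ opposite d → c ≡ d
opposite-injective {white} {white} _ = refl
opposite-injective {black} {black} _ = refl

c≢opposite-c : ∀ c → c ≢ opposite c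
c≢opposite-c white ()
c≢opposite-c black ()

≢⇒≡opposite : ∀ {c d} → c ≢ d → c ≡ opposite d
≢⇒≡opposite {white} {white} c≢d = ⊥-elim (c≢d refl)
≢⇒≡opposite {white} {black} _   = refl
≢⇒≡opposite {black} {white} _   = refl
≢⇒≡opposite {black} {black} c≢d = ⊥-elim (c≢d refl)

record Graph : Set₁ where
  field
    Vertex : Set
    colour : Vertex → Color
    Edge   : Vertex → Vertex → Set

record _≃_ (G H : Graph) : Set where
  private
    module G = Graph G
    module H = Graph H
  field
    to        : G.Vertex → H.Vertex
    from      : H.Vertex → G.Vertex
    to-from   : ∀ y → to (from y) ≡ y
    from-to   : ∀ x → from (to x) ≡ x
    to-colour : ∀ x → H.colour (to x) ≡ G.colour x
    to-edge   : ∀ {x y} → G.Edge x y → H.Edge (to x) (to y)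
    from-edge : ∀ {x y} → H.Edge x y → G.Edge (from x) (from y)

open _≃_ public

≃-refl : ∀ {G} → G ≃ G
≃-refl = record
  { to = λ x → x ; from = λ x → x ; to-from = λ _ → refl ; from-to = λ _ → refl
  ; to-colour = λ _ → refl ; to-edge = λ e → e ; from-edge = λ e → e }

≃-sym : ∀ {G H} → G ≃ H → H ≃ G
≃-sym {G} {H} φ = record
  { to = from φ ; from = to φ ; to-from = from-to φ ; from-to = to-from φ
  ; to-colour = λ y → trans (sym (to-colour φ (from φ y))) (cong (Graph.colour H) (to-from φ y))
  ; to-edge = from-edge φ ; from-edge = to-edge φ }

≃-trans : ∀ {G H K} → G ≃ H → H ≃ K → G ≃ K
≃-trans φ χ = record
  { to = λ x → to χ (to φ x) ; from = λ z → from φ (from χ z)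
  ; to-from = λ z → trans (cong (to χ) (to-from φ (from χ z))) (to-from χ z)
  ; from-to = λ x → trans (cong (from φ) (from-to χ (to φ x))) (from-to φ x)
  ; to-colour = λ x → trans (to-colour χ (to φ x)) (to-colour φ x)
  ; to-edge = λ e → to-edge χ (to-edge φ e) ; from-edge = λ e → from-edge φ (from-edge χ e) }

to-injective : ∀ {G H} (φ : G ≃ H) {x x'} → to φ x ≡ to φ x' → x ≡ x'
to-injective φ {x} {x'} e = trans (sym (from-to φ x)) (trans (cong (from φ) e) (from-to φ x'))

asBGraph : Graph → BGraph
asBGraph G = record { V = P.setoid (Graph.Vertex G) ; color = Graph.colour G ; Adj = Graph.Edge G }

≃⇒≅ : ∀ {G H} → G ≃ H → asBGraph G ≅ asBGraph H
≃⇒≅ {G} φ = record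
  { iso = record
      { to = to φ ; from = from φ ; to-cong = cong (to φ) ; from-cong = cong (from φ)
      ; inverse = (λ { refl → to-from φ _ }) , (λ { refl → from-to φ _ }) }
  ; pres-col = to-colour φ
  ; pres-adj = λ x y → mk⇔ (to-edge φ)
      (λ e → subst₂ (Graph.Edge G) (from-to φ x) (from-to φ y) (from-edge φ e)) }

≅⇒≃ : ∀ {G H} → asBGraph G ≅ asBGraph H → G ≃ H
≅⇒≃ {G} {H} φ = record
  { to = Inverse.to I ; from = Inverse.from I
  ; to-from = Inverse.strictlyInverseˡ I ; from-to = Inverse.strictlyInverseʳ I
  ; to-colour = _≅_.pres-col φ
  ; to-edge = λ {x} {y} → Equivalence.to (_≅_.pres-adj φ x y)
  ; from-edge = λ {x} {y} e → Equivalence.from (_≅_.pres-adj φ _ _)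
      (subst₂ (Graph.Edge H) (sym (Inverse.strictlyInverseˡ I x)) (sym (Inverse.strictlyInverseˡ I y)) e) }
  where I = _≅_.iso φ

≅-trans : ∀ {G H K} → G ≅ H → H ≅ K → G ≅ K
≅-trans φ χ = record
  { iso = Compose.inverse (_≅_.iso φ) (_≅_.iso χ)
  ; pres-col = λ x → trans (_≅_.pres-col χ _) (_≅_.pres-col φ x)
  ; pres-adj = λ x y → mk⇔
      (λ a → Equivalence.to (_≅_.pres-adj χ _ _) (Equivalence.to (_≅_.pres-adj φ x y) a))
      (λ a → Equivalence.from (_≅_.pres-adj φ x y) (Equivalence.from (_≅_.pres-adj χ _ _) a)) }

-- Symmetry needs the target's colours and edges to respect its setoid, which is automatic for asBGraph.
≅-sym : ∀ {G H} → G ≅ asBGraph H → asBGraph H ≅ G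
≅-sym {G} {H} φ = record
  { iso = Symmetry.inverse I
  ; pres-col = λ y → trans (sym (_≅_.pres-col φ (Inverse.from I y)))
                           (cong (Graph.colour H) (Inverse.strictlyInverseˡ I y))
  ; pres-adj = λ x y → mk⇔
      (λ a → Equivalence.from (_≅_.pres-adj φ _ _) (subst₂ (Graph.Edge H) (sym (inv x)) (sym (inv y)) a))
      (λ a → subst₂ (Graph.Edge H) (inv x) (inv y) (Equivalence.to (_≅_.pres-adj φ _ _) a)) }
  where
  I = _≅_.iso φ
  inv = Inverse.strictlyInverseˡ I

addLeaf : (G : Graph) → Graph.Vertex G → Graph
addLeaf G g = record
  { Vertex = Graph.Vertex G ⊎ ⊤
  ; colour = λ { (inj₁ x) → Graph.colour G x ; (inj₂ _) → opposite (Graph.colour G g) }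
  ; Edge = λ { (inj₁ x) (inj₁ y) → Graph.Edge G x y ; (inj₁ x) (inj₂ _) → x ≡ g
             ; (inj₂ _) (inj₁ y) → y ≡ g ; (inj₂ _) (inj₂ _) → ⊥ } }

addLeaf-cong : ∀ {G H} (φ : G ≃ H) (g : Graph.Vertex G) → addLeaf G g ≃ addLeaf H (to φ g)
addLeaf-cong φ g = record
  { to = λ { (inj₁ x) → inj₁ (to φ x) ; (inj₂ t) → inj₂ t }
  ; from = λ { (inj₁ x) → inj₁ (from φ x) ; (inj₂ t) → inj₂ t }
  ; to-from = λ { (inj₁ x) → cong inj₁ (to-from φ x) ; (inj₂ t) → refl }
  ; from-to = λ { (inj₁ x) → cong inj₁ (from-to φ x) ; (inj₂ t) → refl }
  ; to-colour = λ { (inj₁ x) → to-colour φ x ; (inj₂ t) → cong opposite (to-colour φ g) }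
  ; to-edge = λ { {inj₁ x} {inj₁ y} e → to-edge φ e ; {inj₁ x} {inj₂ _} e → cong (to φ) e
                ; {inj₂ _} {inj₁ y} e → cong (to φ) e ; {inj₂ _} {inj₂ _} () }
  ; from-edge = λ { {inj₁ x} {inj₁ y} e → from-edge φ e
                  ; {inj₁ x} {inj₂ _} e → trans (cong (from φ) e) (from-to φ g)
                  ; {inj₂ _} {inj₁ y} e → trans (cong (from φ) e) (from-to φ g)
                  ; {inj₂ _} {inj₂ _} () } }

data Rose : Set where
  rose : List Rose → Rose

mutual
  data Pos : Rose → Set where
    here : ∀ {xs} → Pos (rose xs)
    down : ∀ {xs} → PosF xs → Pos (rose xs)

  data PosF : List Rose → Set where
    hd : ∀ {x xs} → Pos x → PosF (x ∷ xs)
    tl : ∀ {x xs} → PosF xs → PosF (x ∷ xs)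

data IsTop : ∀ {xs} → PosF xs → Set where
  top-hd : ∀ {ys xs} → IsTop {rose ys ∷ xs} (hd here)
  top-tl : ∀ {x xs} {q : PosF xs} → IsTop q → IsTop {x ∷ xs} (tl q)

mutual
  data Child : ∀ {t} → Pos t → Pos t → Set where
    ch-top  : ∀ {xs} {q : PosF xs} → IsTop q → Child {rose xs} here (down q)
    ch-down : ∀ {xs} {q q' : PosF xs} → ChildF q q' → Child {rose xs} (down q) (down q')

  data ChildF : ∀ {xs} → PosF xs → PosF xs → Set where
    ch-hd : ∀ {x xs} {p p' : Pos x} → Child p p' → ChildF {x ∷ xs} (hd p) (hd p')
    ch-tl : ∀ {x xs} {q q' : PosF xs} → ChildF q q' → ChildF {x ∷ xs} (tl q) (tl q')

mutual
  colour : ∀ {t} → Pos t → Color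
  colour here     = white
  colour (down q) = opposite (colourF q)

  colourF : ∀ {xs} → PosF xs → Color
  colourF (hd p) = colour p
  colourF (tl q) = colourF q

Adj : ∀ {t} → Pos t → Pos t → Set
Adj p q = Child p q ⊎ Child q p

AdjF : ∀ {xs} → PosF xs → PosF xs → Set
AdjF p q = ChildF p q ⊎ ChildF q p

Adj-sym : ∀ {t} {p q : Pos t} → Adj p q → Adj q p
Adj-sym (inj₁ c) = inj₂ c
Adj-sym (inj₂ c) = inj₁ c

AdjF-sym : ∀ {xs} {p q : PosF xs} → AdjF p q → AdjF q p
AdjF-sym (inj₁ c) = inj₂ c
AdjF-sym (inj₂ c) = inj₁ c

down-adj : ∀ {xs} {q q' : PosF xs} → AdjF q q' → Adj {rose xs} (down q) (down q')
down-adj (inj₁ c) = inj₁ (ch-down c)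
down-adj (inj₂ c) = inj₂ (ch-down c)

hd-adj : ∀ {x xs} {p p' : Pos x} → Adj p p' → AdjF {x ∷ xs} (hd p) (hd p')
hd-adj (inj₁ c) = inj₁ (ch-hd c)
hd-adj (inj₂ c) = inj₂ (ch-hd c)

tl-adj : ∀ {x xs} {q q' : PosF xs} → AdjF q q' → AdjF {x ∷ xs} (tl q) (tl q')
tl-adj (inj₁ c) = inj₁ (ch-tl c)
tl-adj (inj₂ c) = inj₂ (ch-tl c)

IsTop⇒colourF≡white : ∀ {xs} {q : PosF xs} → IsTop q → colourF q ≡ white
IsTop⇒colourF≡white top-hd     = refl
IsTop⇒colourF≡white (top-tl t) = IsTop⇒colourF≡white t

mutual
  child-colour : ∀ {t} {p q : Pos t} → Child p q → colour q ≡ opposite (colour p)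
  child-colour (ch-top t)  = cong opposite (IsTop⇒colourF≡white t)
  child-colour (ch-down c) = cong opposite (childF-colour c)

  childF-colour : ∀ {xs} {p q : PosF xs} → ChildF p q → colourF q ≡ opposite (colourF p)
  childF-colour (ch-hd c) = child-colour c
  childF-colour (ch-tl c) = childF-colour c

adj-colour : ∀ {t} {p q : Pos t} → Adj p q → colour p ≢ colour q
adj-colour (inj₁ c) e = c≢opposite-c _ (trans e (child-colour c))
adj-colour (inj₂ c) e = c≢opposite-c _ (trans (sym e) (child-colour c))

roseGraph : Rose → Graph
roseGraph t = record { Vertex = Pos t ; colour = colour ; Edge = Adj }

_≃ᴿ_ : Rose → Rose → Set
t ≃ᴿ u = roseGraph t ≃ roseGraph u

record _≃ᶠ_ (xs ys : List Rose) : Set where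
  field
    to        : PosF xs → PosF ys
    from      : PosF ys → PosF xs
    to-from   : ∀ q → to (from q) ≡ q
    from-to   : ∀ p → from (to p) ≡ p
    to-colour : ∀ p → colourF (to p) ≡ colourF p
    to-adj    : ∀ {p q} → AdjF p q → AdjF (to p) (to q)
    from-adj  : ∀ {p q} → AdjF p q → AdjF (from p) (from q)
    to-top    : ∀ {p} → IsTop p → IsTop (to p)
    from-top  : ∀ {p} → IsTop p → IsTop (from p)

open _≃ᶠ_ public

≃ᶠ-refl : ∀ {xs} → xs ≃ᶠ xs
≃ᶠ-refl = record
  { to = λ p → p ; from = λ p → p ; to-from = λ _ → refl ; from-to = λ _ → refl
  ; to-colour = λ _ → refl ; to-adj = λ a → a ; from-adj = λ a → a
  ; to-top = λ t → t ; from-top = λ t → t }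

≃ᶠ-sym : ∀ {xs ys} → xs ≃ᶠ ys → ys ≃ᶠ xs
≃ᶠ-sym φ = record
  { to = from φ ; from = to φ ; to-from = from-to φ ; from-to = to-from φ
  ; to-colour = λ q → trans (sym (to-colour φ (from φ q))) (cong colourF (to-from φ q))
  ; to-adj = from-adj φ ; from-adj = to-adj φ ; to-top = from-top φ ; from-top = to-top φ }

≃ᶠ-trans : ∀ {xs ys zs} → xs ≃ᶠ ys → ys ≃ᶠ zs → xs ≃ᶠ zs
≃ᶠ-trans φ χ = record
  { to = λ p → to χ (to φ p) ; from = λ q → from φ (from χ q)
  ; to-from = λ q → trans (cong (to χ) (to-from φ (from χ q))) (to-from χ q)
  ; from-to = λ p → trans (cong (from φ) (from-to χ (to φ p))) (from-to φ p)
  ; to-colour = λ p → trans (to-colour χ (to φ p)) (to-colour φ p)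
  ; to-adj = λ a → to-adj χ (to-adj φ a) ; from-adj = λ a → from-adj φ (from-adj χ a)
  ; to-top = λ t → to-top χ (to-top φ t) ; from-top = λ t → from-top φ (from-top χ t) }

underRoot : ∀ {xs ys} → xs ≃ᶠ ys → Pos (rose xs) → Pos (rose ys)
underRoot φ here     = here
underRoot φ (down q) = down (to φ q)

underRoot-child : ∀ {xs ys} (φ : xs ≃ᶠ ys) {p q} → Child p q → Adj (underRoot φ p) (underRoot φ q)
underRoot-child φ (ch-top t)  = inj₁ (ch-top (to-top φ t))
underRoot-child φ (ch-down c) = down-adj (to-adj φ (inj₁ c))

underRoot-adj : ∀ {xs ys} (φ : xs ≃ᶠ ys) {p q} → Adj p q → Adj (underRoot φ p) (underRoot φ q)
underRoot-adj φ (inj₁ c) = underRoot-child φ c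
underRoot-adj φ (inj₂ c) = Adj-sym (underRoot-child φ c)

underRoot-inverse : ∀ {xs ys} (φ : xs ≃ᶠ ys) (χ : ys ≃ᶠ xs) →
                    (∀ q → to χ (to φ q) ≡ q) → ∀ p → underRoot χ (underRoot φ p) ≡ p
underRoot-inverse φ χ inv here     = refl
underRoot-inverse φ χ inv (down q) = cong down (inv q)

underRoot-colour : ∀ {xs ys} (φ : xs ≃ᶠ ys) p → colour (underRoot φ p) ≡ colour p
underRoot-colour φ here     = refl
underRoot-colour φ (down q) = cong opposite (to-colour φ q)

underRoot-≃ᴿ : ∀ {xs ys} → xs ≃ᶠ ys → rose xs ≃ᴿ rose ys
underRoot-≃ᴿ φ = record
  { to = underRoot φ ; from = underRoot (≃ᶠ-sym φ)
  ; to-from = underRoot-inverse (≃ᶠ-sym φ) φ (to-from φ)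
  ; from-to = underRoot-inverse φ (≃ᶠ-sym φ) (from-to φ)
  ; to-colour = underRoot-colour φ
  ; to-edge = underRoot-adj φ ; from-edge = underRoot-adj (≃ᶠ-sym φ) }

module _ {x y : Rose} {zs : List Rose} where
  swapFront : PosF (x ∷ y ∷ zs) → PosF (y ∷ x ∷ zs)
  swapFront (hd p)      = tl (hd p)
  swapFront (tl (hd p)) = hd p
  swapFront (tl (tl q)) = tl (tl q)

  swapFront-child : ∀ {p q} → ChildF p q → ChildF (swapFront p) (swapFront q)
  swapFront-child (ch-hd c)         = ch-tl (ch-hd c)
  swapFront-child (ch-tl (ch-hd c)) = ch-hd c
  swapFront-child (ch-tl (ch-tl c)) = ch-tl (ch-tl c)

  swapFront-adj : ∀ {p q} → AdjF p q → AdjF (swapFront p) (swapFront q)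
  swapFront-adj (inj₁ c) = inj₁ (swapFront-child c)
  swapFront-adj (inj₂ c) = inj₂ (swapFront-child c)

  swapFront-top : ∀ {p} → IsTop p → IsTop (swapFront p)
  swapFront-top top-hd              = top-tl top-hd
  swapFront-top (top-tl top-hd)     = top-hd
  swapFront-top (top-tl (top-tl t)) = top-tl (top-tl t)

  swapFront-colour : ∀ p → colourF (swapFront p) ≡ colourF p
  swapFront-colour (hd p)      = refl
  swapFront-colour (tl (hd p)) = refl
  swapFront-colour (tl (tl q)) = refl

swapFront-involutive : ∀ {x y zs} (p : PosF (x ∷ y ∷ zs)) → swapFront (swapFront p) ≡ p
swapFront-involutive (hd p)      = refl
swapFront-involutive (tl (hd p)) = refl
swapFront-involutive (tl (tl q)) = refl

swap-≃ᶠ : ∀ {x y zs} → (x ∷ y ∷ zs) ≃ᶠ (y ∷ x ∷ zs)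
swap-≃ᶠ = record
  { to = swapFront ; from = swapFront ; to-from = swapFront-involutive ; from-to = swapFront-involutive
  ; to-colour = swapFront-colour ; to-adj = swapFront-adj ; from-adj = swapFront-adj
  ; to-top = swapFront-top ; from-top = swapFront-top }

module _ {x : Rose} {xs ys : List Rose} (φ : xs ≃ᶠ ys) where
  onTail : PosF (x ∷ xs) → PosF (x ∷ ys)
  onTail (hd p) = hd p
  onTail (tl q) = tl (to φ q)

  onTail-child : ∀ {p q} → ChildF p q → AdjF (onTail p) (onTail q)
  onTail-child (ch-hd c) = inj₁ (ch-hd c)
  onTail-child (ch-tl c) = tl-adj (to-adj φ (inj₁ c))

  onTail-adj : ∀ {p q} → AdjF p q → AdjF (onTail p) (onTail q)
  onTail-adj (inj₁ c) = onTail-child c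
  onTail-adj (inj₂ c) = AdjF-sym (onTail-child c)

  onTail-top : ∀ {p} → IsTop p → IsTop (onTail p)
  onTail-top top-hd     = top-hd
  onTail-top (top-tl t) = top-tl (to-top φ t)

  onTail-colour : ∀ p → colourF (onTail p) ≡ colourF p
  onTail-colour (hd p) = refl
  onTail-colour (tl q) = to-colour φ q

onTail-inverse : ∀ {x xs ys} (φ : xs ≃ᶠ ys) (χ : ys ≃ᶠ xs) →
                 (∀ q → to χ (to φ q) ≡ q) → ∀ p → onTail {x} χ (onTail φ p) ≡ p
onTail-inverse φ χ inv (hd p) = refl
onTail-inverse φ χ inv (tl q) = cong tl (inv q)

tail-≃ᶠ : ∀ {x xs ys} → xs ≃ᶠ ys → (x ∷ xs) ≃ᶠ (x ∷ ys)
tail-≃ᶠ φ = record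
  { to = onTail φ ; from = onTail (≃ᶠ-sym φ)
  ; to-from = onTail-inverse (≃ᶠ-sym φ) φ (to-from φ)
  ; from-to = onTail-inverse φ (≃ᶠ-sym φ) (from-to φ)
  ; to-colour = onTail-colour φ ; to-adj = onTail-adj φ ; from-adj = onTail-adj (≃ᶠ-sym φ)
  ; to-top = onTail-top φ ; from-top = onTail-top (≃ᶠ-sym φ) }

module _ {zs cs ds : List Rose} (φ : cs ≃ᶠ ds) where
  onHead : PosF (rose cs ∷ zs) → PosF (rose ds ∷ zs)
  onHead (hd p) = hd (underRoot φ p)
  onHead (tl q) = tl q

  onHead-child : ∀ {p q} → ChildF p q → AdjF (onHead p) (onHead q)
  onHead-child (ch-hd c) = hd-adj (underRoot-child φ c)
  onHead-child (ch-tl c) = inj₁ (ch-tl c)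

  onHead-adj : ∀ {p q} → AdjF p q → AdjF (onHead p) (onHead q)
  onHead-adj (inj₁ c) = onHead-child c
  onHead-adj (inj₂ c) = AdjF-sym (onHead-child c)

  onHead-top : ∀ {p} → IsTop p → IsTop (onHead p)
  onHead-top top-hd     = top-hd
  onHead-top (top-tl t) = top-tl t

  onHead-colour : ∀ p → colourF (onHead p) ≡ colourF p
  onHead-colour (hd p) = underRoot-colour φ p
  onHead-colour (tl q) = refl

onHead-inverse : ∀ {zs cs ds} (φ : cs ≃ᶠ ds) (χ : ds ≃ᶠ cs) →
                 (∀ q → to χ (to φ q) ≡ q) → ∀ p → onHead {zs} χ (onHead φ p) ≡ p
onHead-inverse φ χ inv (hd p) = cong hd (underRoot-inverse φ χ inv p)
onHead-inverse φ χ inv (tl q) = refl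

head-≃ᶠ : ∀ {zs cs ds} → cs ≃ᶠ ds → (rose cs ∷ zs) ≃ᶠ (rose ds ∷ zs)
head-≃ᶠ φ = record
  { to = onHead φ ; from = onHead (≃ᶠ-sym φ)
  ; to-from = onHead-inverse (≃ᶠ-sym φ) φ (to-from φ)
  ; from-to = onHead-inverse φ (≃ᶠ-sym φ) (from-to φ)
  ; to-colour = onHead-colour φ ; to-adj = onHead-adj φ ; from-adj = onHead-adj (≃ᶠ-sym φ)
  ; to-top = onHead-top φ ; from-top = onHead-top (≃ᶠ-sym φ) }

data Swap : List Rose → List Rose → Set where
  swap-here : ∀ {x y zs} → Swap (x ∷ y ∷ zs) (y ∷ x ∷ zs)
  swap-tail : ∀ {x xs ys} → Swap xs ys → Swap (x ∷ xs) (x ∷ ys)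
  swap-head : ∀ {cs ds zs} → Swap cs ds → Swap (rose cs ∷ zs) (rose ds ∷ zs)

Swap⇒≃ᶠ : ∀ {xs ys} → Swap xs ys → xs ≃ᶠ ys
Swap⇒≃ᶠ swap-here     = swap-≃ᶠ
Swap⇒≃ᶠ (swap-tail s) = tail-≃ᶠ (Swap⇒≃ᶠ s)
Swap⇒≃ᶠ (swap-head s) = head-≃ᶠ (Swap⇒≃ᶠ s)

grandchildTree : List Rose → List Rose → List Rose → Rose
grandchildTree Y W Z = rose (rose (rose Y ∷ W) ∷ Z)

-- grandchildTree Z W Y is grandchildTree Y W Z rerooted at the first grandchild of its root.
module _ {Y W Z : List Rose} where
  reroot : Pos (grandchildTree Y W Z) → Pos (grandchildTree Z W Y)
  reroot here                             = down (hd (down (hd here)))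
  reroot (down (hd here))                 = down (hd here)
  reroot (down (hd (down (hd here))))     = here
  reroot (down (hd (down (hd (down y))))) = down (tl y)
  reroot (down (hd (down (tl w))))        = down (hd (down (tl w)))
  reroot (down (tl z))                    = down (hd (down (hd (down z))))

  reroot-child : {p q : Pos (grandchildTree Y W Z)} → Child p q → Adj (reroot p) (reroot q)
  reroot-child (ch-top top-hd)                                 = inj₂ (ch-down (ch-hd (ch-top top-hd)))
  reroot-child (ch-top (top-tl t))                             = inj₁ (ch-down (ch-hd (ch-down (ch-hd (ch-top t)))))
  reroot-child (ch-down (ch-hd (ch-top top-hd)))               = inj₂ (ch-top top-hd)
  reroot-child (ch-down (ch-hd (ch-top (top-tl t))))           = inj₁ (ch-down (ch-hd (ch-top (top-tl t))))
  reroot-child (ch-down (ch-hd (ch-down (ch-hd (ch-top t)))))  = inj₁ (ch-top (top-tl t))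
  reroot-child (ch-down (ch-hd (ch-down (ch-hd (ch-down c))))) = inj₁ (ch-down (ch-tl c))
  reroot-child (ch-down (ch-hd (ch-down (ch-tl c))))           = inj₁ (ch-down (ch-hd (ch-down (ch-tl c))))
  reroot-child (ch-down (ch-tl c))                             = inj₁ (ch-down (ch-hd (ch-down (ch-hd (ch-down c)))))

  reroot-adj : {p q : Pos (grandchildTree Y W Z)} → Adj p q → Adj (reroot p) (reroot q)
  reroot-adj (inj₁ c) = reroot-child c
  reroot-adj (inj₂ c) = Adj-sym (reroot-child c)

  reroot-colour : (p : Pos (grandchildTree Y W Z)) → colour (reroot p) ≡ colour p
  reroot-colour here                             = refl
  reroot-colour (down (hd here))                 = refl
  reroot-colour (down (hd (down (hd here))))     = refl
  reroot-colour (down (hd (down (hd (down y))))) = cong opposite (sym (opposite-involutive (colourF y)))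
  reroot-colour (down (hd (down (tl w))))        = refl
  reroot-colour (down (tl z))                    = cong opposite (opposite-involutive (colourF z))

reroot-involutive : ∀ {Y W Z} (p : Pos (grandchildTree Y W Z)) → reroot (reroot p) ≡ p
reroot-involutive here                             = refl
reroot-involutive (down (hd here))                 = refl
reroot-involutive (down (hd (down (hd here))))     = refl
reroot-involutive (down (hd (down (hd (down y))))) = refl
reroot-involutive (down (hd (down (tl w))))        = refl
reroot-involutive (down (tl z))                    = refl

reroot-≃ᴿ : ∀ {Y W Z} → grandchildTree Y W Z ≃ᴿ grandchildTree Z W Y
reroot-≃ᴿ = record
  { to = reroot ; from = reroot ; to-from = reroot-involutive ; from-to = reroot-involutive
  ; to-colour = reroot-colour ; to-edge = reroot-adj ; from-edge = reroot-adj }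

data ForestStep : List Rose → List Rose → Set where
  step-swap   : ∀ {xs ys} → Swap xs ys → ForestStep xs ys
  step-reroot : ∀ {Y W Z} → ForestStep (rose (rose Y ∷ W) ∷ Z) (rose (rose Z ∷ W) ∷ Y)

ForestStep⇒≃ᴿ : ∀ {xs ys} → ForestStep xs ys → rose xs ≃ᴿ rose ys
ForestStep⇒≃ᴿ (step-swap s) = underRoot-≃ᴿ (Swap⇒≃ᶠ s)
ForestStep⇒≃ᴿ step-reroot   = reroot-≃ᴿ

ForestEquiv⇒≃ᴿ : ∀ {xs ys} → EqClosure ForestStep xs ys → rose xs ≃ᴿ rose ys
ForestEquiv⇒≃ᴿ ε            = ≃-refl
ForestEquiv⇒≃ᴿ (fwd s ◅ ss) = ≃-trans (ForestStep⇒≃ᴿ s) (ForestEquiv⇒≃ᴿ ss)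
ForestEquiv⇒≃ᴿ (bwd s ◅ ss) = ≃-trans (≃-sym (ForestStep⇒≃ᴿ s)) (ForestEquiv⇒≃ᴿ ss)

-- A binary tree as the plane tree rooted at the left block of its root: the subtrees of a left block
-- are the right blocks through its nodes, read along the left branch, and vice versa.
mutual
  whiteForest : BT → List Rose
  whiteForest leaf       = []
  whiteForest (node A B) = rose (blackForest B) ∷ whiteForest A

  blackForest : BT → List Rose
  blackForest leaf       = []
  blackForest (node A B) = rose (whiteForest A) ∷ blackForest B

mutual
  ofWhiteForest : List Rose → BT
  ofWhiteForest []           = leaf
  ofWhiteForest (rose f ∷ g) = node (ofWhiteForest g) (ofBlackForest f)

  ofBlackForest : List Rose → BT
  ofBlackForest []           = leaf
  ofBlackForest (rose f ∷ g) = node (ofWhiteForest f) (ofBlackForest g)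

mutual
  ofWhiteForest-whiteForest : ∀ T → ofWhiteForest (whiteForest T) ≡ T
  ofWhiteForest-whiteForest leaf       = refl
  ofWhiteForest-whiteForest (node A B) = cong₂ node (ofWhiteForest-whiteForest A) (ofBlackForest-blackForest B)

  ofBlackForest-blackForest : ∀ T → ofBlackForest (blackForest T) ≡ T
  ofBlackForest-blackForest leaf       = refl
  ofBlackForest-blackForest (node A B) = cong₂ node (ofWhiteForest-whiteForest A) (ofBlackForest-blackForest B)

mutual
  whiteForest-ofWhiteForest : ∀ xs → whiteForest (ofWhiteForest xs) ≡ xs
  whiteForest-ofWhiteForest []           = refl
  whiteForest-ofWhiteForest (rose f ∷ g) =
    cong₂ (λ a b → rose a ∷ b) (blackForest-ofBlackForest f) (whiteForest-ofWhiteForest g)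

  blackForest-ofBlackForest : ∀ xs → blackForest (ofBlackForest xs) ≡ xs
  blackForest-ofBlackForest []           = refl
  blackForest-ofBlackForest (rose f ∷ g) =
    cong₂ (λ a b → rose a ∷ b) (whiteForest-ofWhiteForest f) (blackForest-ofBlackForest g)

mutual
  leftMove⇒Swap : ∀ {T T'} → Move lft T T' → Swap (whiteForest T) (whiteForest T')
  leftMove⇒Swap (R-here isLeft) = swap-here
  leftMove⇒Swap (go-left m)     = swap-tail (leftMove⇒Swap m)
  leftMove⇒Swap (go-right m)    = swap-head (rightMove⇒Swap m)

  rightMove⇒Swap : ∀ {T T'} → Move rgt T T' → Swap (blackForest T) (blackForest T')
  rightMove⇒Swap (L-here isRight) = swap-here
  rightMove⇒Swap (go-left m)      = swap-head (leftMove⇒Swap m)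
  rightMove⇒Swap (go-right m)     = swap-tail (rightMove⇒Swap m)

LRStep⇒ForestStep : ∀ {T T'} → LRStep T T' → ForestStep (whiteForest T) (whiteForest T')
LRStep⇒ForestStep (L-here isRoot) = step-reroot
LRStep⇒ForestStep (R-here isRoot) = step-swap swap-here
LRStep⇒ForestStep (go-left m)     = step-swap (swap-tail (leftMove⇒Swap m))
LRStep⇒ForestStep (go-right m)    = step-swap (swap-head (rightMove⇒Swap m))

mutual
  Swap⇒leftMove : ∀ {xs ys} → Swap xs ys → Move lft (ofWhiteForest xs) (ofWhiteForest ys)
  Swap⇒leftMove (swap-here {rose _} {rose _}) = R-here isLeft
  Swap⇒leftMove (swap-tail {rose _} s)        = go-left (Swap⇒leftMove s)
  Swap⇒leftMove (swap-head s)                 = go-right (Swap⇒rightMove s)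

  Swap⇒rightMove : ∀ {xs ys} → Swap xs ys → Move rgt (ofBlackForest xs) (ofBlackForest ys)
  Swap⇒rightMove (swap-here {rose _} {rose _}) = L-here isRight
  Swap⇒rightMove (swap-tail {rose _} s)        = go-right (Swap⇒rightMove s)
  Swap⇒rightMove (swap-head s)                 = go-left (Swap⇒leftMove s)

ForestStep⇒LRStep : ∀ {xs ys} → ForestStep xs ys → LRStep (ofWhiteForest xs) (ofWhiteForest ys)
ForestStep⇒LRStep (step-swap (swap-here {rose _} {rose _})) = R-here isRoot
ForestStep⇒LRStep (step-swap (swap-tail {rose _} s))        = go-left (Swap⇒leftMove s)
ForestStep⇒LRStep (step-swap (swap-head s))                 = go-right (Swap⇒rightMove s)
ForestStep⇒LRStep step-reroot                               = L-here isRoot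

LREquiv⇒≃ᴿ : ∀ {T T'} → LREquiv T T' → rose (whiteForest T) ≃ᴿ rose (whiteForest T')
LREquiv⇒≃ᴿ e = ForestEquiv⇒≃ᴿ (EqClosure.gmap whiteForest LRStep⇒ForestStep e)

ForestEquiv⇒LREquiv : ∀ {T T'} → EqClosure ForestStep (whiteForest T) (whiteForest T') → LREquiv T T'
ForestEquiv⇒LREquiv {T} {T'} e =
  subst₂ LREquiv (ofWhiteForest-whiteForest T) (ofWhiteForest-whiteForest T')
    (EqClosure.gmap ofWhiteForest ForestStep⇒LRStep e)

mutual
  pathFromRoot : ∀ {xs} (p : Pos (rose xs)) → Star Adj here p
  pathFromRoot here     = ε
  pathFromRoot (down q) with pathFromTop q
  ... | t , top , path = inj₁ (ch-top top) ◅ Star.gmap down down-adj path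

  pathFromTop : ∀ {xs} (q : PosF xs) → ∃ λ t → IsTop t × Star AdjF t q
  pathFromTop (hd {rose _} p) = hd here , top-hd , Star.gmap hd hd-adj (pathFromRoot p)
  pathFromTop (tl q) with pathFromTop q
  ... | t , top , path = tl t , top-tl top , Star.gmap tl tl-adj path

InHead : ∀ {y ys} → PosF (y ∷ ys) → Set
InHead (hd _) = ⊤
InHead (tl _) = ⊥

InTail : ∀ {y ys} → PosF (y ∷ ys) → Set
InTail (hd _) = ⊥
InTail (tl _) = ⊤

headOf : ∀ {y ys} (a : PosF (y ∷ ys)) → InHead a → Pos y
headOf (hd p) _ = p

tailOf : ∀ {y ys} (a : PosF (y ∷ ys)) → InTail a → PosF ys
tailOf (tl q) _ = q

hd-headOf : ∀ {y ys} (a : PosF (y ∷ ys)) h → hd (headOf a h) ≡ a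
hd-headOf (hd p) _ = refl

tl-tailOf : ∀ {y ys} (a : PosF (y ∷ ys)) h → tl (tailOf a h) ≡ a
tl-tailOf (tl q) _ = refl

hd-injective : ∀ {x xs} {a b : Pos x} → hd {x} {xs} a ≡ hd b → a ≡ b
hd-injective refl = refl

tl-injective : ∀ {x xs} {a b : PosF xs} → tl {x} {xs} a ≡ tl b → a ≡ b
tl-injective refl = refl

down-injective : ∀ {xs} {a b : PosF xs} → down {xs} a ≡ down b → a ≡ b
down-injective refl = refl

hd-adj⁻¹ : ∀ {x xs} {a b : Pos x} → AdjF {x ∷ xs} (hd a) (hd b) → Adj a b
hd-adj⁻¹ (inj₁ (ch-hd c)) = inj₁ c
hd-adj⁻¹ (inj₂ (ch-hd c)) = inj₂ c

tl-adj⁻¹ : ∀ {x xs} {a b : PosF xs} → AdjF {x ∷ xs} (tl a) (tl b) → AdjF a b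
tl-adj⁻¹ (inj₁ (ch-tl c)) = inj₁ c
tl-adj⁻¹ (inj₂ (ch-tl c)) = inj₂ c

down-adj⁻¹ : ∀ {xs} {a b : PosF xs} → Adj {rose xs} (down a) (down b) → AdjF a b
down-adj⁻¹ (inj₁ (ch-down c)) = inj₁ c
down-adj⁻¹ (inj₂ (ch-down c)) = inj₂ c

here-adj⁻¹ : ∀ {xs} {a : PosF xs} → Adj {rose xs} here (down a) → IsTop a
here-adj⁻¹ (inj₁ (ch-top t)) = t

tl-top⁻¹ : ∀ {x xs} {a : PosF xs} → IsTop {x ∷ xs} (tl a) → IsTop a
tl-top⁻¹ (top-tl t) = t

InHead-closed : ∀ {y ys} {a b : PosF (y ∷ ys)} → InHead a → Star AdjF a b → InHead b
InHead-closed h ε = h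
InHead-closed {a = hd _} h (inj₁ (ch-hd _) ◅ path) = InHead-closed tt path
InHead-closed {a = hd _} h (inj₂ (ch-hd _) ◅ path) = InHead-closed tt path

to-star : ∀ {xs ys} (φ : xs ≃ᶠ ys) {p q} → Star AdjF p q → Star AdjF (to φ p) (to φ q)
to-star φ = Star.gmap (to φ) (to-adj φ)

-- The head tree is connected, so an isomorphism fixing its root keeps it in place.
keepsHead : ∀ {cs ds xs ys} (φ : (rose cs ∷ xs) ≃ᶠ (rose ds ∷ ys)) →
            to φ (hd here) ≡ hd here → ∀ p → InHead (to φ (hd p))
keepsHead φ fix p =
  InHead-closed (subst InHead (sym fix) tt) (to-star φ (Star.gmap hd hd-adj (pathFromRoot p)))

module Split {x y : Rose} {xs ys : List Rose} (φ : (x ∷ xs) ≃ᶠ (y ∷ ys))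
             (keeps : ∀ p → InHead (to φ (hd p))) (keeps⁻ : ∀ p → InHead (from φ (hd p))) where

  keepsTail : ∀ q → InTail (to φ (tl q))
  keepsTail q with to φ (tl q) in eq
  ... | tl _ = tt
  ... | hd a = subst InHead (trans (cong (from φ) (sym eq)) (from-to φ (tl q))) (keeps⁻ a)

  keepsTail⁻ : ∀ q → InTail (from φ (tl q))
  keepsTail⁻ q with from φ (tl q) in eq
  ... | tl _ = tt
  ... | hd a = subst InHead (trans (cong (to φ) (sym eq)) (to-from φ (tl q))) (keeps a)

  headTo : Pos x → Pos y
  headTo p = headOf (to φ (hd p)) (keeps p)

  headFrom : Pos y → Pos x
  headFrom p = headOf (from φ (hd p)) (keeps⁻ p)

  tailTo : PosF xs → PosF ys
  tailTo q = tailOf (to φ (tl q)) (keepsTail q)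

  tailFrom : PosF ys → PosF xs
  tailFrom q = tailOf (from φ (tl q)) (keepsTail⁻ q)

  hd-headTo : ∀ p → hd (headTo p) ≡ to φ (hd p)
  hd-headTo p = hd-headOf _ (keeps p)

  hd-headFrom : ∀ p → hd (headFrom p) ≡ from φ (hd p)
  hd-headFrom p = hd-headOf _ (keeps⁻ p)

  tl-tailTo : ∀ q → tl (tailTo q) ≡ to φ (tl q)
  tl-tailTo q = tl-tailOf _ (keepsTail q)

  tl-tailFrom : ∀ q → tl (tailFrom q) ≡ from φ (tl q)
  tl-tailFrom q = tl-tailOf _ (keepsTail⁻ q)

  headIso : x ≃ᴿ y
  headIso = record
    { to = headTo ; from = headFrom
    ; to-from = λ p → hd-injective (trans (hd-headTo (headFrom p))
                        (trans (cong (to φ) (hd-headFrom p)) (to-from φ (hd p))))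
    ; from-to = λ p → hd-injective (trans (hd-headFrom (headTo p))
                        (trans (cong (from φ) (hd-headTo p)) (from-to φ (hd p))))
    ; to-colour = λ p → trans (cong colourF (hd-headTo p)) (to-colour φ (hd p))
    ; to-edge = λ {p} {q} a →
        hd-adj⁻¹ (subst₂ AdjF (sym (hd-headTo p)) (sym (hd-headTo q)) (to-adj φ (hd-adj a)))
    ; from-edge = λ {p} {q} a →
        hd-adj⁻¹ (subst₂ AdjF (sym (hd-headFrom p)) (sym (hd-headFrom q)) (from-adj φ (hd-adj a))) }

  tailIso : xs ≃ᶠ ys
  tailIso = record
    { to = tailTo ; from = tailFrom
    ; to-from = λ q → tl-injective (trans (tl-tailTo (tailFrom q))
                        (trans (cong (to φ) (tl-tailFrom q)) (to-from φ (tl q))))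
    ; from-to = λ q → tl-injective (trans (tl-tailFrom (tailTo q))
                        (trans (cong (from φ) (tl-tailTo q)) (from-to φ (tl q))))
    ; to-colour = λ q → trans (cong colourF (tl-tailTo q)) (to-colour φ (tl q))
    ; to-adj = λ {p} {q} a →
        tl-adj⁻¹ (subst₂ AdjF (sym (tl-tailTo p)) (sym (tl-tailTo q)) (to-adj φ (tl-adj a)))
    ; from-adj = λ {p} {q} a →
        tl-adj⁻¹ (subst₂ AdjF (sym (tl-tailFrom p)) (sym (tl-tailFrom q)) (from-adj φ (tl-adj a)))
    ; to-top = λ {q} t → tl-top⁻¹ (subst IsTop (sym (tl-tailTo q)) (to-top φ (top-tl t)))
    ; from-top = λ {q} t → tl-top⁻¹ (subst IsTop (sym (tl-tailFrom q)) (from-top φ (top-tl t))) }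

IsDown : ∀ {xs} → Pos (rose xs) → Set
IsDown here     = ⊥
IsDown (down _) = ⊤

downOf : ∀ {xs} (p : Pos (rose xs)) → IsDown p → PosF xs
downOf (down q) _ = q

down-downOf : ∀ {xs} (p : Pos (rose xs)) h → down (downOf p h) ≡ p
down-downOf (down q) _ = refl

module FixRoot {xs ys : List Rose} (φ : rose xs ≃ᴿ rose ys) (fix : to φ here ≡ here) where

  fix⁻ : from φ here ≡ here
  fix⁻ = trans (cong (from φ) (sym fix)) (from-to φ here)

  movesDown : ∀ q → IsDown (to φ (down q))
  movesDown q with to φ (down q) in eq
  ... | down _ = tt
  ... | here   = subst IsDown (to-injective φ (trans eq (sym fix))) tt

  movesDown⁻ : ∀ q → IsDown (from φ (down q))
  movesDown⁻ q with from φ (down q) in eq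
  ... | down _ = tt
  ... | here   = subst IsDown (to-injective (≃-sym φ) (trans eq (sym fix⁻))) tt

  belowTo : PosF xs → PosF ys
  belowTo q = downOf (to φ (down q)) (movesDown q)

  belowFrom : PosF ys → PosF xs
  belowFrom q = downOf (from φ (down q)) (movesDown⁻ q)

  down-belowTo : ∀ q → down (belowTo q) ≡ to φ (down q)
  down-belowTo q = down-downOf _ (movesDown q)

  down-belowFrom : ∀ q → down (belowFrom q) ≡ from φ (down q)
  down-belowFrom q = down-downOf _ (movesDown⁻ q)

  belowIso : xs ≃ᶠ ys
  belowIso = record
    { to = belowTo ; from = belowFrom
    ; to-from = λ q → down-injective (trans (down-belowTo (belowFrom q))
                        (trans (cong (to φ) (down-belowFrom q)) (to-from φ (down q))))
    ; from-to = λ q → down-injective (trans (down-belowFrom (belowTo q))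
                        (trans (cong (from φ) (down-belowTo q)) (from-to φ (down q))))
    ; to-colour = λ q → opposite-injective (trans (cong colour (down-belowTo q)) (to-colour φ (down q)))
    ; to-adj = λ {p} {q} a →
        down-adj⁻¹ (subst₂ Adj (sym (down-belowTo p)) (sym (down-belowTo q)) (to-edge φ (down-adj a)))
    ; from-adj = λ {p} {q} a →
        down-adj⁻¹ (subst₂ Adj (sym (down-belowFrom p)) (sym (down-belowFrom q)) (from-edge φ (down-adj a)))
    ; to-top = λ {q} t →
        here-adj⁻¹ (subst₂ Adj fix (sym (down-belowTo q)) (to-edge φ (inj₁ (ch-top t))))
    ; from-top = λ {q} t →
        here-adj⁻¹ (subst₂ Adj fix⁻ (sym (down-belowFrom q)) (from-edge φ (inj₁ (ch-top t)))) }

splitAtRoot : ∀ {cs ds xs ys} (φ : (rose cs ∷ xs) ≃ᶠ (rose ds ∷ ys)) → to φ (hd here) ≡ hd here →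
              cs ≃ᶠ ds × xs ≃ᶠ ys
splitAtRoot φ fix = FixRoot.belowIso headIso (hd-injective (trans (hd-headTo here) fix)) , tailIso
  where
  fix⁻ : from φ (hd here) ≡ hd here
  fix⁻ = trans (cong (from φ) (sym fix)) (from-to φ (hd here))
  open Split φ (keepsHead φ fix) (keepsHead (≃ᶠ-sym φ) fix⁻)

mutual
  depth : ∀ {t} → Pos t → ℕ
  depth here     = 0
  depth (down q) = suc (depthF q)

  depthF : ∀ {xs} → PosF xs → ℕ
  depthF (hd p) = depth p
  depthF (tl q) = depthF q

-- Up to swaps, any position of a forest lies in its first tree.
record Front (ys : List Rose) (q : PosF ys) : Set where
  constructor front
  field
    {tree}     : Rose
    {others}   : List Rose
    pos        : Pos tree
    swaps      : Star Swap (tree ∷ others) ys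
    iso        : (tree ∷ others) ≃ᶠ ys
    iso-pos    : to iso (hd pos) ≡ q
    depth-pos  : depth pos ≡ depthF q
    colour-pos : colour pos ≡ colourF q

toFront : ∀ {ys} (q : PosF ys) → Front ys q
toFront (hd p) = front p ε ≃ᶠ-refl refl refl refl
toFront (tl {x} q) with toFront q
... | front p s φ e d c =
  front p (swap-here ◅ Star.gmap (x ∷_) swap-tail s) (≃ᶠ-trans swap-≃ᶠ (tail-≃ᶠ φ)) (cong tl e) d c

IsTop⇒depthF≡0 : ∀ {xs} {q : PosF xs} → IsTop q → depthF q ≡ 0
IsTop⇒depthF≡0 top-hd     = refl
IsTop⇒depthF≡0 (top-tl t) = IsTop⇒depthF≡0 t

PosF[]-empty : PosF [] → ⊥
PosF[]-empty ()

-- Peel off the first tree: move the root its image lands on to the front, then recurse on the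
-- subtrees of that root and on the remaining trees.
≃ᶠ⇒Swap* : ∀ xs ys → xs ≃ᶠ ys → Star Swap xs ys
≃ᶠ⇒Swap* [] []             φ = ε
≃ᶠ⇒Swap* [] (rose _ ∷ _)   φ = ⊥-elim (PosF[]-empty (from φ (hd here)))
≃ᶠ⇒Swap* (rose cs ∷ xs) ys φ with toFront (to φ (hd here))
... | front (down _) _ _ _ d _ =
  ⊥-elim (1+n≢0 (trans d (IsTop⇒depthF≡0 (to-top φ (top-hd {cs} {xs})))))
... | front {rose ds} {others} here s χ e _ _ =
  Star.gmap (λ c → rose c ∷ xs) swap-head (≃ᶠ⇒Swap* cs ds (proj₁ parts))
  ◅◅ Star.gmap (rose ds ∷_) swap-tail (≃ᶠ⇒Swap* xs others (proj₂ parts)) ◅◅ s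
  where
  parts = splitAtRoot (≃ᶠ-trans φ (≃ᶠ-sym χ)) (trans (cong (from χ) (sym e)) (from-to χ (hd here)))

liftTail : ∀ {x xs} → Pos (rose xs) → Pos (rose (x ∷ xs))
liftTail here     = here
liftTail (down q) = down (tl q)

liftTail-depth : ∀ {x xs} (p : Pos (rose xs)) → depth (liftTail {x} p) ≡ depth p
liftTail-depth here     = refl
liftTail-depth (down q) = refl

liftTail-colour : ∀ {x xs} (p : Pos (rose xs)) → colour (liftTail {x} p) ≡ colour p
liftTail-colour here     = refl
liftTail-colour (down q) = refl

reroot-liftTail : ∀ {Y W Z} (p : Pos (rose Y)) →
                  reroot {Z} {W} {Y} (liftTail p) ≡ down (hd (down (hd p)))
reroot-liftTail here     = refl
reroot-liftTail (down q) = refl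

Swap*⇒ForestEquiv : ∀ {xs ys} → Star Swap xs ys → EqClosure ForestStep xs ys
Swap*⇒ForestEquiv = Star.gmap (λ xs → xs) (λ s → fwd (step-swap s))

record Climb (xs : List Rose) (q : PosF xs) : Set where
  constructor climbed
  field
    {forest}   : List Rose
    pos        : Pos (rose forest)
    steps      : EqClosure ForestStep xs forest
    iso        : rose forest ≃ᴿ rose xs
    iso-pos    : to iso pos ≡ down q
    colour-pos : colour pos ≡ colour (down q)
    depth-pos  : suc (suc (depth pos)) ≡ depth (down q)

-- A white vertex below the root has a grandparent; after swaps it sits in the first subtree of the
-- first subtree of the root, and one reroot step lifts it two levels.
climb : ∀ {xs} (q : PosF xs) → colour (down q) ≡ white → Climb xs q
climb q isWhite with toFront q
... | front here _ _ _ _ c = ⊥-elim (black≢white (trans (cong opposite c) isWhite))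
  where
  black≢white : black ≢ white
  black≢white ()
... | front {rose cs} {rest} (down q₂) s₁ φ₁ e₁ d₁ c₁ with toFront q₂
...   | front {rose Y} {rest₂} p s₂ φ₂ e₂ d₂ c₂ =
  climbed (liftTail p) steps iso iso-pos colour-pos depth-pos
  where
  steps : EqClosure ForestStep _ (rose (rose rest ∷ rest₂) ∷ Y)
  steps = EqClosure.symmetric _ (Swap*⇒ForestEquiv s₁)
       ◅◅ EqClosure.symmetric _ (Swap*⇒ForestEquiv (Star.gmap (λ c → rose c ∷ rest) swap-head s₂))
       ◅◅ fwd step-reroot ◅ ε

  iso : rose (rose (rose rest ∷ rest₂) ∷ Y) ≃ᴿ rose _
  iso = ≃-trans reroot-≃ᴿ (≃-trans (underRoot-≃ᴿ (head-≃ᶠ φ₂)) (underRoot-≃ᴿ φ₁))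

  iso-pos : to iso (liftTail p) ≡ down q
  iso-pos = begin
    underRoot φ₁ (underRoot (head-≃ᶠ φ₂) (reroot (liftTail p)))
      ≡⟨ cong (λ z → underRoot φ₁ (underRoot (head-≃ᶠ φ₂) z)) (reroot-liftTail p) ⟩
    underRoot φ₁ (down (hd (down (to φ₂ (hd p)))))
      ≡⟨ cong (λ z → underRoot φ₁ (down (hd (down z)))) e₂ ⟩
    down (to φ₁ (hd (down q₂)))
      ≡⟨ cong down e₁ ⟩
    down q ∎
    where open ≡-Reasoning

  colour-pos : colour (liftTail p) ≡ colour (down q)
  colour-pos = trans (liftTail-colour p)
               (trans c₂ (trans (sym (opposite-involutive _)) (cong opposite c₁)))

  depth-pos : suc (suc (depth (liftTail p))) ≡ depth (down q)
  depth-pos = cong suc (trans (cong suc (trans (liftTail-depth p) d₂)) d₁)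

record RootedAt (xs : List Rose) (p : Pos (rose xs)) : Set where
  constructor rootedAt
  field
    {forest} : List Rose
    steps    : EqClosure ForestStep xs forest
    iso      : rose forest ≃ᴿ rose xs
    iso-root : to iso here ≡ p

-- Only white vertices can become the root: the isomorphisms preserve colours and the root is white.
rerootAt : ∀ n {xs} (p : Pos (rose xs)) → colour p ≡ white → depth p ≤ n → RootedAt xs p
rerootAt n here _ _ = rootedAt ε ≃-refl refl
rerootAt n (down q) isWhite bound with climb q isWhite
rerootAt zero (down q) _ () | _
rerootAt (suc zero) (down q) _ (s≤s bound) | climbed _ _ _ _ _ d
  with subst (_≤ 0) (sym (suc-injective d)) bound
... | ()
rerootAt (suc (suc n)) (down q) isWhite bound | climbed p s φ e c d with
  rerootAt n p (trans c isWhite) (s≤s⁻¹ (s≤s⁻¹ (subst (_≤ suc (suc n)) (sym d) bound)))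
... | rootedAt s′ φ′ e′ = rootedAt (s ◅◅ s′) (≃-trans φ′ φ) (trans (cong (to φ) e′) e)

≃ᴿ⇒ForestEquiv : ∀ {xs ys} → rose xs ≃ᴿ rose ys → EqClosure ForestStep xs ys
≃ᴿ⇒ForestEquiv {ys = ys} φ with rerootAt _ (from φ here) (to-colour (≃-sym φ) here) ≤-refl
... | rootedAt s χ e = s ◅◅ Swap*⇒ForestEquiv (≃ᶠ⇒Swap* _ ys (FixRoot.belowIso (≃-trans χ φ) fixes))
  where
  fixes : to φ (to χ here) ≡ here
  fixes = trans (cong (to φ) e) (to-from φ here)

-- The vertices of ψ S: a node standing for its left block (inj₁) or for its right block (inj₂).
Block : BT → Set
Block S = Node S ⊎ Node S

_≈ᴮ_ : ∀ {S} → Block S → Block S → Set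
_≈ᴮ_ {S} = Setoid._≈_ (BGraph.V (ψ S))

≈ᴮ-refl : ∀ {S} {z : Block S} → z ≈ᴮ z
≈ᴮ-refl {S} = Setoid.refl (BGraph.V (ψ S))

≈ᴮ-sym : ∀ {S} {z z' : Block S} → z ≈ᴮ z' → z' ≈ᴮ z
≈ᴮ-sym {S} = Setoid.sym (BGraph.V (ψ S))

≈ᴮ-trans : ∀ {S} {z z' z″ : Block S} → z ≈ᴮ z' → z' ≈ᴮ z″ → z ≈ᴮ z″
≈ᴮ-trans {S} = Setoid.trans (BGraph.V (ψ S))

inL-≈ᴮ : ∀ {A B} {z z' : Block A} → z ≈ᴮ z' →
         _≈ᴮ_ {node A B} (Sum.map inL inL z) (Sum.map inL inL z')
inL-≈ᴮ (Pointwise.inj₁ e) = Pointwise.inj₁ (EqClosure.gmap inL le-L e)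
inL-≈ᴮ (Pointwise.inj₂ e) = Pointwise.inj₂ (EqClosure.gmap inL re-L e)

inR-≈ᴮ : ∀ {A B} {z z' : Block B} → z ≈ᴮ z' →
         _≈ᴮ_ {node A B} (Sum.map inR inR z) (Sum.map inR inR z')
inR-≈ᴮ (Pointwise.inj₁ e) = Pointwise.inj₁ (EqClosure.gmap inR le-R e)
inR-≈ᴮ (Pointwise.inj₂ e) = Pointwise.inj₂ (EqClosure.gmap inR re-R e)

-- The left and right block of a node as vertices of rose (whiteForest S) (ᵂ) and of rose (blackForest S)
-- (ᴮ); in the white tree a right block is never the root, hence a position of the forest.
mutual
  leftBlockᵂ : ∀ {S} → Node S → Pos (rose (whiteForest S))
  leftBlockᵂ here    = here
  leftBlockᵂ (inL k) = liftTail (leftBlockᵂ k)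
  leftBlockᵂ (inR k) = down (hd (down (leftBlockᴮ k)))

  rightBlockᵂ : ∀ {S} → Node S → PosF (whiteForest S)
  rightBlockᵂ here    = hd here
  rightBlockᵂ (inL k) = tl (rightBlockᵂ k)
  rightBlockᵂ (inR k) = hd (rightBlockᴮ k)

  rightBlockᴮ : ∀ {S} → Node S → Pos (rose (blackForest S))
  rightBlockᴮ here    = here
  rightBlockᴮ (inR k) = liftTail (rightBlockᴮ k)
  rightBlockᴮ (inL k) = down (hd (down (rightBlockᵂ k)))

  leftBlockᴮ : ∀ {S} → Node S → PosF (blackForest S)
  leftBlockᴮ here    = hd here
  leftBlockᴮ (inR k) = tl (leftBlockᴮ k)
  leftBlockᴮ (inL k) = hd (leftBlockᵂ k)

mutual
  leftBlockᵂ-edge : ∀ {S} {k k' : Node S} → LeftEdge k k' → leftBlockᵂ k ≡ leftBlockᵂ k'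
  leftBlockᵂ-edge le-here  = refl
  leftBlockᵂ-edge (le-L e) = cong liftTail (leftBlockᵂ-edge e)
  leftBlockᵂ-edge (le-R e) = cong (λ z → down (hd (down z))) (leftBlockᴮ-edge e)

  leftBlockᴮ-edge : ∀ {S} {k k' : Node S} → LeftEdge k k' → leftBlockᴮ k ≡ leftBlockᴮ k'
  leftBlockᴮ-edge le-here  = refl
  leftBlockᴮ-edge (le-L e) = cong hd (leftBlockᵂ-edge e)
  leftBlockᴮ-edge (le-R e) = cong tl (leftBlockᴮ-edge e)

mutual
  rightBlockᵂ-edge : ∀ {S} {k k' : Node S} → RightEdge k k' → rightBlockᵂ k ≡ rightBlockᵂ k'
  rightBlockᵂ-edge re-here  = refl
  rightBlockᵂ-edge (re-L e) = cong tl (rightBlockᵂ-edge e)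
  rightBlockᵂ-edge (re-R e) = cong hd (rightBlockᴮ-edge e)

  rightBlockᴮ-edge : ∀ {S} {k k' : Node S} → RightEdge k k' → rightBlockᴮ k ≡ rightBlockᴮ k'
  rightBlockᴮ-edge re-here  = refl
  rightBlockᴮ-edge (re-L e) = cong (λ z → down (hd (down z))) (rightBlockᵂ-edge e)
  rightBlockᴮ-edge (re-R e) = cong liftTail (rightBlockᴮ-edge e)

mutual
  leftBlockᵂ-colour : ∀ {S} (k : Node S) → colour (leftBlockᵂ k) ≡ white
  leftBlockᵂ-colour here    = refl
  leftBlockᵂ-colour (inL k) = trans (liftTail-colour (leftBlockᵂ k)) (leftBlockᵂ-colour k)
  leftBlockᵂ-colour (inR k) = trans (opposite-involutive (colourF (leftBlockᴮ k))) (leftBlockᴮ-colour k)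

  rightBlockᵂ-colour : ∀ {S} (k : Node S) → colourF (rightBlockᵂ k) ≡ white
  rightBlockᵂ-colour here    = refl
  rightBlockᵂ-colour (inL k) = rightBlockᵂ-colour k
  rightBlockᵂ-colour (inR k) = rightBlockᴮ-colour k

  rightBlockᴮ-colour : ∀ {S} (k : Node S) → colour (rightBlockᴮ k) ≡ white
  rightBlockᴮ-colour here    = refl
  rightBlockᴮ-colour (inR k) = trans (liftTail-colour (rightBlockᴮ k)) (rightBlockᴮ-colour k)
  rightBlockᴮ-colour (inL k) = trans (opposite-involutive (colourF (rightBlockᵂ k))) (rightBlockᵂ-colour k)

  leftBlockᴮ-colour : ∀ {S} (k : Node S) → colourF (leftBlockᴮ k) ≡ white
  leftBlockᴮ-colour here    = refl
  leftBlockᴮ-colour (inR k) = leftBlockᴮ-colour k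
  leftBlockᴮ-colour (inL k) = leftBlockᵂ-colour k

liftTail-child : ∀ {x xs} {p q : Pos (rose xs)} → Child p q → Child (liftTail {x} p) (liftTail q)
liftTail-child (ch-top t)  = ch-top (top-tl t)
liftTail-child (ch-down c) = ch-down (ch-tl c)

liftTail-adj : ∀ {x xs} {p q : Pos (rose xs)} → Adj p q → Adj (liftTail {x} p) (liftTail q)
liftTail-adj (inj₁ c) = inj₁ (liftTail-child c)
liftTail-adj (inj₂ c) = inj₂ (liftTail-child c)

mutual
  blocksᵂ-adj : ∀ {S} (k : Node S) → Adj (leftBlockᵂ k) (down (rightBlockᵂ k))
  blocksᵂ-adj here    = inj₁ (ch-top top-hd)
  blocksᵂ-adj (inL k) = liftTail-adj (blocksᵂ-adj k)
  blocksᵂ-adj (inR k) = Adj-sym (down-adj (hd-adj (blocksᴮ-adj k)))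

  blocksᴮ-adj : ∀ {S} (k : Node S) → Adj (rightBlockᴮ k) (down (leftBlockᴮ k))
  blocksᴮ-adj here    = inj₁ (ch-top top-hd)
  blocksᴮ-adj (inR k) = liftTail-adj (blocksᴮ-adj k)
  blocksᴮ-adj (inL k) = Adj-sym (down-adj (hd-adj (blocksᵂ-adj k)))

EdgeAtᵂ : ∀ S → Pos (rose (whiteForest S)) → Pos (rose (whiteForest S)) → Set
EdgeAtᵂ S p q = ∃ λ k → (leftBlockᵂ k ≡ p × down (rightBlockᵂ k) ≡ q)
                       ⊎ (down (rightBlockᵂ k) ≡ p × leftBlockᵂ k ≡ q)

EdgeAtᴮ : ∀ S → Pos (rose (blackForest S)) → Pos (rose (blackForest S)) → Set
EdgeAtᴮ S p q = ∃ λ k → (rightBlockᴮ k ≡ p × down (leftBlockᴮ k) ≡ q)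
                       ⊎ (down (leftBlockᴮ k) ≡ p × rightBlockᴮ k ≡ q)

liftTail-EdgeAtᵂ : ∀ {A B p q} → EdgeAtᵂ A p q → EdgeAtᵂ (node A B) (liftTail p) (liftTail q)
liftTail-EdgeAtᵂ (k , inj₁ (a , b)) = inL k , inj₁ (cong liftTail a , cong liftTail b)
liftTail-EdgeAtᵂ (k , inj₂ (a , b)) = inL k , inj₂ (cong liftTail a , cong liftTail b)

liftTail-EdgeAtᴮ : ∀ {A B p q} → EdgeAtᴮ B p q → EdgeAtᴮ (node A B) (liftTail p) (liftTail q)
liftTail-EdgeAtᴮ (k , inj₁ (a , b)) = inR k , inj₁ (cong liftTail a , cong liftTail b)
liftTail-EdgeAtᴮ (k , inj₂ (a , b)) = inR k , inj₂ (cong liftTail a , cong liftTail b)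

mutual
  child⇒EdgeAtᵂ : ∀ S {p q : Pos (rose (whiteForest S))} → Child p q → EdgeAtᵂ S p q
  child⇒EdgeAtᵂ (node A B) (ch-top top-hd)     = here , inj₁ (refl , refl)
  child⇒EdgeAtᵂ (node A B) (ch-top (top-tl t)) = liftTail-EdgeAtᵂ (child⇒EdgeAtᵂ A (ch-top t))
  child⇒EdgeAtᵂ (node A B) (ch-down (ch-tl c)) = liftTail-EdgeAtᵂ (child⇒EdgeAtᵂ A (ch-down c))
  child⇒EdgeAtᵂ (node A B) (ch-down (ch-hd c)) with child⇒EdgeAtᴮ B c
  ... | k , inj₁ (a , b) = inR k , inj₂ (cong (λ z → down (hd z)) a , cong (λ z → down (hd z)) b)
  ... | k , inj₂ (a , b) = inR k , inj₁ (cong (λ z → down (hd z)) a , cong (λ z → down (hd z)) b)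

  child⇒EdgeAtᴮ : ∀ S {p q : Pos (rose (blackForest S))} → Child p q → EdgeAtᴮ S p q
  child⇒EdgeAtᴮ (node A B) (ch-top top-hd)     = here , inj₁ (refl , refl)
  child⇒EdgeAtᴮ (node A B) (ch-top (top-tl t)) = liftTail-EdgeAtᴮ (child⇒EdgeAtᴮ B (ch-top t))
  child⇒EdgeAtᴮ (node A B) (ch-down (ch-tl c)) = liftTail-EdgeAtᴮ (child⇒EdgeAtᴮ B (ch-down c))
  child⇒EdgeAtᴮ (node A B) (ch-down (ch-hd c)) with child⇒EdgeAtᵂ A c
  ... | k , inj₁ (a , b) = inL k , inj₂ (cong (λ z → down (hd z)) a , cong (λ z → down (hd z)) b)
  ... | k , inj₂ (a , b) = inL k , inj₁ (cong (λ z → down (hd z)) a , cong (λ z → down (hd z)) b)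

blockᵂ : ∀ {S} → Block S → Pos (rose (whiteForest S))
blockᵂ (inj₁ k) = leftBlockᵂ k
blockᵂ (inj₂ k) = down (rightBlockᵂ k)

blockᴮ : ∀ {S} → Block S → Pos (rose (blackForest S))
blockᴮ (inj₁ k) = down (leftBlockᴮ k)
blockᴮ (inj₂ k) = rightBlockᴮ k

blockᵂ-inL : ∀ {A B} (z : Block A) → blockᵂ {node A B} (Sum.map inL inL z) ≡ liftTail (blockᵂ z)
blockᵂ-inL (inj₁ k) = refl
blockᵂ-inL (inj₂ k) = refl

blockᵂ-inR : ∀ {A B} (z : Block B) → blockᵂ {node A B} (Sum.map inR inR z) ≡ down (hd (blockᴮ z))
blockᵂ-inR (inj₁ k) = refl
blockᵂ-inR (inj₂ k) = refl

blockᴮ-inL : ∀ {A B} (z : Block A) → blockᴮ {node A B} (Sum.map inL inL z) ≡ down (hd (blockᵂ z))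
blockᴮ-inL (inj₁ k) = refl
blockᴮ-inL (inj₂ k) = refl

blockᴮ-inR : ∀ {A B} (z : Block B) → blockᴮ {node A B} (Sum.map inR inR z) ≡ liftTail (blockᴮ z)
blockᴮ-inR (inj₁ k) = refl
blockᴮ-inR (inj₂ k) = refl

mutual
  blockBelowᵂ : ∀ S → PosF (whiteForest S) → Block S
  blockBelowᵂ (node A B) (hd here)     = inj₂ here
  blockBelowᵂ (node A B) (hd (down q)) = Sum.map inR inR (blockBelowᴮ B q)
  blockBelowᵂ (node A B) (tl q)        = Sum.map inL inL (blockBelowᵂ A q)

  blockBelowᴮ : ∀ S → PosF (blackForest S) → Block S
  blockBelowᴮ (node A B) (hd here)     = inj₁ here
  blockBelowᴮ (node A B) (hd (down q)) = Sum.map inL inL (blockBelowᵂ A q)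
  blockBelowᴮ (node A B) (tl q)        = Sum.map inR inR (blockBelowᴮ B q)

blockOfᵂ : ∀ {A B} → Pos (rose (whiteForest (node A B))) → Block (node A B)
blockOfᵂ here           = inj₁ here
blockOfᵂ {A} {B} (down q) = blockBelowᵂ (node A B) q

blockOfᴮ : ∀ {A B} → Pos (rose (blackForest (node A B))) → Block (node A B)
blockOfᴮ here           = inj₂ here
blockOfᴮ {A} {B} (down q) = blockBelowᴮ (node A B) q

mutual
  blockᵂ-blockBelowᵂ : ∀ S (q : PosF (whiteForest S)) → blockᵂ (blockBelowᵂ S q) ≡ down q
  blockᵂ-blockBelowᵂ (node A B) (hd here)     = refl
  blockᵂ-blockBelowᵂ (node A B) (hd (down q)) =
    trans (blockᵂ-inR (blockBelowᴮ B q)) (cong (λ z → down (hd z)) (blockᴮ-blockBelowᴮ B q))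
  blockᵂ-blockBelowᵂ (node A B) (tl q)        =
    trans (blockᵂ-inL (blockBelowᵂ A q)) (cong liftTail (blockᵂ-blockBelowᵂ A q))

  blockᴮ-blockBelowᴮ : ∀ S (q : PosF (blackForest S)) → blockᴮ (blockBelowᴮ S q) ≡ down q
  blockᴮ-blockBelowᴮ (node A B) (hd here)     = refl
  blockᴮ-blockBelowᴮ (node A B) (hd (down q)) =
    trans (blockᴮ-inL (blockBelowᵂ A q)) (cong (λ z → down (hd z)) (blockᵂ-blockBelowᵂ A q))
  blockᴮ-blockBelowᴮ (node A B) (tl q)        =
    trans (blockᴮ-inR (blockBelowᴮ B q)) (cong liftTail (blockᴮ-blockBelowᴮ B q))

blockOfᵂ-liftTail : ∀ {A₁ A₂ B} (p : Pos (rose (whiteForest (node A₁ A₂)))) →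
                    blockOfᵂ {node A₁ A₂} {B} (liftTail p) ≈ᴮ Sum.map inL inL (blockOfᵂ p)
blockOfᵂ-liftTail here     = Pointwise.inj₁ (fwd le-here ◅ ε)
blockOfᵂ-liftTail (down q) = ≈ᴮ-refl

blockOfᴮ-liftTail : ∀ {A B₁ B₂} (p : Pos (rose (blackForest (node B₁ B₂)))) →
                    blockOfᴮ {A} {node B₁ B₂} (liftTail p) ≈ᴮ Sum.map inR inR (blockOfᴮ p)
blockOfᴮ-liftTail here     = Pointwise.inj₂ (fwd re-here ◅ ε)
blockOfᴮ-liftTail (down q) = ≈ᴮ-refl

blockBelowᵂ-hd : ∀ {A B₁ B₂} (p : Pos (rose (blackForest (node B₁ B₂)))) →
                 blockBelowᵂ (node A (node B₁ B₂)) (hd p) ≈ᴮ Sum.map inR inR (blockOfᴮ p)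
blockBelowᵂ-hd here     = Pointwise.inj₂ (fwd re-here ◅ ε)
blockBelowᵂ-hd (down q) = ≈ᴮ-refl

blockBelowᴮ-hd : ∀ {A₁ A₂ B} (p : Pos (rose (whiteForest (node A₁ A₂)))) →
                 blockBelowᴮ (node (node A₁ A₂) B) (hd p) ≈ᴮ Sum.map inL inL (blockOfᵂ p)
blockBelowᴮ-hd here     = Pointwise.inj₁ (fwd le-here ◅ ε)
blockBelowᴮ-hd (down q) = ≈ᴮ-refl

mutual
  blockOfᵂ-leftBlockᵂ : ∀ {A B} (k : Node (node A B)) → blockOfᵂ (leftBlockᵂ k) ≈ᴮ inj₁ k
  blockOfᵂ-leftBlockᵂ here               = ≈ᴮ-refl
  blockOfᵂ-leftBlockᵂ {node _ _} (inL k) =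
    ≈ᴮ-trans (blockOfᵂ-liftTail (leftBlockᵂ k)) (inL-≈ᴮ (blockOfᵂ-leftBlockᵂ k))
  blockOfᵂ-leftBlockᵂ {A} {B} (inR k)    = inR-≈ᴮ (blockBelowᴮ-leftBlockᴮ B k)

  blockBelowᴮ-leftBlockᴮ : ∀ S (k : Node S) → blockBelowᴮ S (leftBlockᴮ k) ≈ᴮ inj₁ k
  blockBelowᴮ-leftBlockᴮ (node A B) here         = ≈ᴮ-refl
  blockBelowᴮ-leftBlockᴮ (node (node _ _) B) (inL k) =
    ≈ᴮ-trans (blockBelowᴮ-hd (leftBlockᵂ k)) (inL-≈ᴮ (blockOfᵂ-leftBlockᵂ k))
  blockBelowᴮ-leftBlockᴮ (node A B) (inR k)      = inR-≈ᴮ (blockBelowᴮ-leftBlockᴮ B k)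

  blockOfᴮ-rightBlockᴮ : ∀ {A B} (k : Node (node A B)) → blockOfᴮ (rightBlockᴮ k) ≈ᴮ inj₂ k
  blockOfᴮ-rightBlockᴮ here                   = ≈ᴮ-refl
  blockOfᴮ-rightBlockᴮ {A} {node _ _} (inR k) =
    ≈ᴮ-trans (blockOfᴮ-liftTail (rightBlockᴮ k)) (inR-≈ᴮ (blockOfᴮ-rightBlockᴮ k))
  blockOfᴮ-rightBlockᴮ {A} {B} (inL k)        = inL-≈ᴮ (blockBelowᵂ-rightBlockᵂ A k)

  blockBelowᵂ-rightBlockᵂ : ∀ S (k : Node S) → blockBelowᵂ S (rightBlockᵂ k) ≈ᴮ inj₂ k
  blockBelowᵂ-rightBlockᵂ (node A B) here             = ≈ᴮ-refl
  blockBelowᵂ-rightBlockᵂ (node A (node _ _)) (inR k) =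
    ≈ᴮ-trans (blockBelowᵂ-hd (rightBlockᴮ k)) (inR-≈ᴮ (blockOfᴮ-rightBlockᴮ k))
  blockBelowᵂ-rightBlockᵂ (node A B) (inL k)          = inL-≈ᴮ (blockBelowᵂ-rightBlockᵂ A k)

module _ {A B : BT} where
  private
    S = node A B

  leftBlockᵂ-cong : {k k' : Node S} → EqClosure (LeftEdge {S}) k k' → leftBlockᵂ k ≡ leftBlockᵂ k'
  leftBlockᵂ-cong = EqClosure.gfold P.isEquivalence leftBlockᵂ leftBlockᵂ-edge

  rightBlockᵂ-cong : {k k' : Node S} → EqClosure (RightEdge {S}) k k' → rightBlockᵂ k ≡ rightBlockᵂ k'
  rightBlockᵂ-cong = EqClosure.gfold P.isEquivalence rightBlockᵂ rightBlockᵂ-edge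

  blockᵂ-cong : {z z' : Block S} → z ≈ᴮ z' → blockᵂ z ≡ blockᵂ z'
  blockᵂ-cong (Pointwise.inj₁ e) = leftBlockᵂ-cong e
  blockᵂ-cong (Pointwise.inj₂ e) = cong down (rightBlockᵂ-cong e)

  blockᵂ-blockOfᵂ : (p : Pos (rose (whiteForest S))) → blockᵂ (blockOfᵂ p) ≡ p
  blockᵂ-blockOfᵂ here     = refl
  blockᵂ-blockOfᵂ (down q) = blockᵂ-blockBelowᵂ S q

  blockOfᵂ-blockᵂ : (z : Block S) → blockOfᵂ (blockᵂ z) ≈ᴮ z
  blockOfᵂ-blockᵂ (inj₁ k) = blockOfᵂ-leftBlockᵂ k
  blockOfᵂ-blockᵂ (inj₂ k) = blockBelowᵂ-rightBlockᵂ S k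

  leftBlockᵂ-injective : {k k' : Node S} → leftBlockᵂ k ≡ leftBlockᵂ k' → EqClosure (LeftEdge {S}) k k'
  leftBlockᵂ-injective {k} {k'} e = Pointwise.drop-inj₁ (≈ᴮ-trans (≈ᴮ-sym (blockOfᵂ-leftBlockᵂ k))
    (subst (λ z → blockOfᵂ z ≈ᴮ inj₁ k') (sym e) (blockOfᵂ-leftBlockᵂ k')))

  rightBlockᵂ-injective : {k k' : Node S} → rightBlockᵂ k ≡ rightBlockᵂ k' →
                          EqClosure (RightEdge {S}) k k'
  rightBlockᵂ-injective {k} {k'} e = Pointwise.drop-inj₂
    (≈ᴮ-trans (≈ᴮ-sym (blockBelowᵂ-rightBlockᵂ S k))
              (subst (λ z → blockBelowᵂ S z ≈ᴮ inj₂ k') (sym e) (blockBelowᵂ-rightBlockᵂ S k')))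

  leftBlock≢rightBlock : (k k' : Node S) → leftBlockᵂ k ≢ down (rightBlockᵂ k')
  leftBlock≢rightBlock k k' e = c≢opposite-c white
    (trans (sym (leftBlockᵂ-colour k)) (trans (cong colour e) (cong opposite (rightBlockᵂ-colour k'))))

  adj⇒ψ-adj : (k k' : Node S) → Adj (leftBlockᵂ k) (down (rightBlockᵂ k')) →
              ψ-adj {S} (inj₁ k) (inj₂ k')
  adj⇒ψ-adj k k' (inj₁ c) with child⇒EdgeAtᵂ S c
  ... | j , inj₁ (a , b) = j , leftBlockᵂ-injective (sym a) , rightBlockᵂ-injective (down-injective (sym b))
  ... | j , inj₂ (a , b) = ⊥-elim (leftBlock≢rightBlock k j (sym a))
  adj⇒ψ-adj k k' (inj₂ c) with child⇒EdgeAtᵂ S c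
  ... | j , inj₁ (a , b) = ⊥-elim (leftBlock≢rightBlock k j (sym b))
  ... | j , inj₂ (a , b) = j , leftBlockᵂ-injective (sym b) , rightBlockᵂ-injective (down-injective (sym a))

  ψ-adj⇒adj : (k k' j : Node S) → EqClosure (LeftEdge {S}) k j → EqClosure (RightEdge {S}) k' j →
              Adj (leftBlockᵂ k) (down (rightBlockᵂ k'))
  ψ-adj⇒adj k k' j l r =
    subst₂ Adj (sym (leftBlockᵂ-cong l)) (sym (cong down (rightBlockᵂ-cong r))) (blocksᵂ-adj j)

  ψ-adj⇔adj : (z z' : Block S) → ψ-adj z z' ⇔ Adj (blockᵂ z) (blockᵂ z')
  ψ-adj⇔adj (inj₁ k) (inj₂ k') =
    mk⇔ (λ { (j , l , r) → ψ-adj⇒adj k k' j l r }) (adj⇒ψ-adj k k')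
  ψ-adj⇔adj (inj₂ k) (inj₁ k') =
    mk⇔ (λ { (j , l , r) → Adj-sym (ψ-adj⇒adj k' k j l r) }) (λ a → adj⇒ψ-adj k' k (Adj-sym a))
  ψ-adj⇔adj (inj₁ k) (inj₁ k') =
    mk⇔ (λ ()) (λ a → adj-colour a (trans (leftBlockᵂ-colour k) (sym (leftBlockᵂ-colour k'))))
  ψ-adj⇔adj (inj₂ k) (inj₂ k') =
    mk⇔ (λ ()) (λ a → adj-colour a
      (cong opposite (trans (rightBlockᵂ-colour k) (sym (rightBlockᵂ-colour k')))))

  blockᵂ-colour : (z : Block S) → colour (blockᵂ z) ≡ ψ-col z
  blockᵂ-colour (inj₁ k) = leftBlockᵂ-colour k
  blockᵂ-colour (inj₂ k) = cong opposite (rightBlockᵂ-colour k)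

  ψ≅whiteTree : ψ S ≅ asBGraph (roseGraph (rose (whiteForest S)))
  ψ≅whiteTree = record
    { iso = record
        { to = blockᵂ ; from = blockOfᵂ ; to-cong = blockᵂ-cong ; from-cong = λ { refl → ≈ᴮ-refl }
        ; inverse = (λ { {x} e → trans (blockᵂ-cong e) (blockᵂ-blockOfᵂ x) })
                  , (λ { {x} refl → blockOfᵂ-blockᵂ x }) }
    ; pres-col = blockᵂ-colour
    ; pres-adj = ψ-adj⇔adj }

LREquiv⇔ψ≅ : ∀ {A B A' B'} → LREquiv (node A B) (node A' B') ⇔ (ψ (node A B) ≅ ψ (node A' B'))
LREquiv⇔ψ≅ = mk⇔
  (λ e → ≅-trans ψ≅whiteTree (≅-trans (≃⇒≅ (LREquiv⇒≃ᴿ e)) (≅-sym ψ≅whiteTree)))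
  (λ φ → ForestEquiv⇒LREquiv
           (≃ᴿ⇒ForestEquiv (≅⇒≃ (≅-trans (≅-sym ψ≅whiteTree) (≅-trans φ ψ≅whiteTree)))))

mutual
  order : Rose → ℕ
  order (rose xs) = suc (orderF xs)

  orderF : List Rose → ℕ
  orderF []       = 0
  orderF (x ∷ xs) = order x + orderF xs

mutual
  graftLeaf : (t : Rose) → Pos t → Rose
  graftLeaf (rose xs) here     = rose (rose [] ∷ xs)
  graftLeaf (rose xs) (down q) = rose (graftLeafF xs q)

  graftLeafF : (xs : List Rose) → PosF xs → List Rose
  graftLeafF (x ∷ xs) (hd p) = graftLeaf x p ∷ xs
  graftLeafF (x ∷ xs) (tl q) = x ∷ graftLeafF xs q

mutual
  order-graftLeaf : ∀ t (p : Pos t) → order (graftLeaf t p) ≡ suc (order t)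
  order-graftLeaf (rose xs) here     = refl
  order-graftLeaf (rose xs) (down q) = cong suc (orderF-graftLeafF xs q)

  orderF-graftLeafF : ∀ xs (q : PosF xs) → orderF (graftLeafF xs q) ≡ suc (orderF xs)
  orderF-graftLeafF (x ∷ xs) (hd p) = cong (_+ orderF xs) (order-graftLeaf x p)
  orderF-graftLeafF (x ∷ xs) (tl q) =
    trans (cong (order x +_) (orderF-graftLeafF xs q)) (+-suc (order x) (orderF xs))

mutual
  old : ∀ {t} (p : Pos t) → Pos t → Pos (graftLeaf t p)
  old here      here     = here
  old here      (down q) = down (tl q)
  old (down q₀) here     = here
  old (down q₀) (down q) = down (oldF q₀ q)

  oldF : ∀ {xs} (q₀ : PosF xs) → PosF xs → PosF (graftLeafF xs q₀)
  oldF (hd p₀) (hd p) = hd (old p₀ p)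
  oldF (hd p₀) (tl q) = tl q
  oldF (tl q₀) (hd p) = hd p
  oldF (tl q₀) (tl q) = tl (oldF q₀ q)

mutual
  new : ∀ {t} (p : Pos t) → Pos (graftLeaf t p)
  new here      = down (hd here)
  new (down q₀) = down (newF q₀)

  newF : ∀ {xs} (q₀ : PosF xs) → PosF (graftLeafF xs q₀)
  newF (hd p₀) = hd (new p₀)
  newF (tl q₀) = tl (newF q₀)

mutual
  classify : ∀ {t} (p : Pos t) → Pos (graftLeaf t p) → Pos t ⊎ ⊤
  classify here      here            = inj₁ here
  classify here      (down (hd here)) = inj₂ tt
  classify here      (down (tl q))   = inj₁ (down q)
  classify (down q₀) here            = inj₁ here
  classify (down q₀) (down q)        = Sum.map₁ down (classifyF q₀ q)

  classifyF : ∀ {xs} (q₀ : PosF xs) → PosF (graftLeafF xs q₀) → PosF xs ⊎ ⊤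
  classifyF (hd p₀) (hd p) = Sum.map₁ hd (classify p₀ p)
  classifyF (hd p₀) (tl q) = inj₁ (tl q)
  classifyF (tl q₀) (hd p) = inj₁ (hd p)
  classifyF (tl q₀) (tl q) = Sum.map₁ tl (classifyF q₀ q)

join : ∀ {t} (p : Pos t) → Pos t ⊎ ⊤ → Pos (graftLeaf t p)
join p (inj₁ a) = old p a
join p (inj₂ _) = new p

joinF : ∀ {xs} (q₀ : PosF xs) → PosF xs ⊎ ⊤ → PosF (graftLeafF xs q₀)
joinF q₀ (inj₁ a) = oldF q₀ a
joinF q₀ (inj₂ _) = newF q₀

join-down : ∀ {xs} (q₀ : PosF xs) z → join (down q₀) (Sum.map₁ down z) ≡ down (joinF q₀ z)
join-down q₀ (inj₁ _) = refl
join-down q₀ (inj₂ _) = refl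

joinF-hd : ∀ {x xs} (p₀ : Pos x) z → joinF {x ∷ xs} (hd p₀) (Sum.map₁ hd z) ≡ hd (join p₀ z)
joinF-hd p₀ (inj₁ _) = refl
joinF-hd p₀ (inj₂ _) = refl

joinF-tl : ∀ {x xs} (q₀ : PosF xs) z → joinF {x ∷ xs} (tl q₀) (Sum.map₁ tl z) ≡ tl (joinF q₀ z)
joinF-tl q₀ (inj₁ _) = refl
joinF-tl q₀ (inj₂ _) = refl

mutual
  join-classify : ∀ {t} (p : Pos t) x → join p (classify p x) ≡ x
  join-classify here      here             = refl
  join-classify here      (down (hd here)) = refl
  join-classify here      (down (tl q))    = refl
  join-classify (down q₀) here             = refl
  join-classify (down q₀) (down q)         =
    trans (join-down q₀ (classifyF q₀ q)) (cong down (joinF-classifyF q₀ q))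

  joinF-classifyF : ∀ {xs} (q₀ : PosF xs) x → joinF q₀ (classifyF q₀ x) ≡ x
  joinF-classifyF (hd p₀) (hd p) = trans (joinF-hd p₀ (classify p₀ p)) (cong hd (join-classify p₀ p))
  joinF-classifyF (hd p₀) (tl q) = refl
  joinF-classifyF (tl q₀) (hd p) = refl
  joinF-classifyF (tl q₀) (tl q) = trans (joinF-tl q₀ (classifyF q₀ q)) (cong tl (joinF-classifyF q₀ q))

mutual
  classify-old : ∀ {t} (p : Pos t) a → classify p (old p a) ≡ inj₁ a
  classify-old here      here     = refl
  classify-old here      (down q) = refl
  classify-old (down q₀) here     = refl
  classify-old (down q₀) (down q) = cong (Sum.map₁ down) (classifyF-oldF q₀ q)

  classifyF-oldF : ∀ {xs} (q₀ : PosF xs) a → classifyF q₀ (oldF q₀ a) ≡ inj₁ a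
  classifyF-oldF (hd p₀) (hd p) = cong (Sum.map₁ hd) (classify-old p₀ p)
  classifyF-oldF (hd p₀) (tl q) = refl
  classifyF-oldF (tl q₀) (hd p) = refl
  classifyF-oldF (tl q₀) (tl q) = cong (Sum.map₁ tl) (classifyF-oldF q₀ q)

mutual
  classify-new : ∀ {t} (p : Pos t) → classify p (new p) ≡ inj₂ tt
  classify-new here      = refl
  classify-new (down q₀) = cong (Sum.map₁ down) (classifyF-newF q₀)

  classifyF-newF : ∀ {xs} (q₀ : PosF xs) → classifyF q₀ (newF q₀) ≡ inj₂ tt
  classifyF-newF (hd p₀) = cong (Sum.map₁ hd) (classify-new p₀)
  classifyF-newF (tl q₀) = cong (Sum.map₁ tl) (classifyF-newF q₀)

mutual
  old-colour : ∀ {t} (p : Pos t) a → colour (old p a) ≡ colour a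
  old-colour here      here     = refl
  old-colour here      (down q) = refl
  old-colour (down q₀) here     = refl
  old-colour (down q₀) (down q) = cong opposite (oldF-colour q₀ q)

  oldF-colour : ∀ {xs} (q₀ : PosF xs) a → colourF (oldF q₀ a) ≡ colourF a
  oldF-colour (hd p₀) (hd p) = old-colour p₀ p
  oldF-colour (hd p₀) (tl q) = refl
  oldF-colour (tl q₀) (hd p) = refl
  oldF-colour (tl q₀) (tl q) = oldF-colour q₀ q

mutual
  new-colour : ∀ {t} (p : Pos t) → colour (new p) ≡ opposite (colour p)
  new-colour here      = refl
  new-colour (down q₀) = cong opposite (newF-colour q₀)

  newF-colour : ∀ {xs} (q₀ : PosF xs) → colourF (newF q₀) ≡ opposite (colourF q₀)
  newF-colour (hd p₀) = new-colour p₀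
  newF-colour (tl q₀) = newF-colour q₀

old-top-hd : ∀ {ys xs} (p₀ : Pos (rose ys)) → IsTop {graftLeaf (rose ys) p₀ ∷ xs} (hd (old p₀ here))
old-top-hd here     = top-hd
old-top-hd (down q) = top-hd

mutual
  old-child : ∀ {t} (p : Pos t) {a b} → Child a b → Child (old p a) (old p b)
  old-child here      (ch-top t)  = ch-top (top-tl t)
  old-child here      (ch-down c) = ch-down (ch-tl c)
  old-child (down q₀) (ch-top t)  = ch-top (oldF-top q₀ t)
  old-child (down q₀) (ch-down c) = ch-down (oldF-child q₀ c)

  oldF-child : ∀ {xs} (q₀ : PosF xs) {a b} → ChildF a b → ChildF (oldF q₀ a) (oldF q₀ b)
  oldF-child (hd p₀) (ch-hd c) = ch-hd (old-child p₀ c)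
  oldF-child (hd p₀) (ch-tl c) = ch-tl c
  oldF-child (tl q₀) (ch-hd c) = ch-hd c
  oldF-child (tl q₀) (ch-tl c) = ch-tl (oldF-child q₀ c)

  oldF-top : ∀ {xs} (q₀ : PosF xs) {a} → IsTop a → IsTop (oldF q₀ a)
  oldF-top (hd p₀) top-hd     = old-top-hd p₀
  oldF-top (hd p₀) (top-tl t) = top-tl t
  oldF-top (tl q₀) top-hd     = top-hd
  oldF-top (tl q₀) (top-tl t) = top-tl (oldF-top q₀ t)

mutual
  old-child⁻¹ : ∀ {t} (p : Pos t) (a b : Pos t) → Child (old p a) (old p b) → Child a b
  old-child⁻¹ here      here     (down q)  (ch-top (top-tl t)) = ch-top t
  old-child⁻¹ here      (down q) (down q') (ch-down (ch-tl c)) = ch-down c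
  old-child⁻¹ (down q₀) here     (down q)  (ch-top t)          = ch-top (oldF-top⁻¹ q₀ q t)
  old-child⁻¹ (down q₀) (down q) (down q') (ch-down c)         = ch-down (oldF-child⁻¹ q₀ q q' c)

  oldF-child⁻¹ : ∀ {xs} (q₀ : PosF xs) (a b : PosF xs) → ChildF (oldF q₀ a) (oldF q₀ b) → ChildF a b
  oldF-child⁻¹ (hd p₀) (hd a) (hd b) (ch-hd c) = ch-hd (old-child⁻¹ p₀ a b c)
  oldF-child⁻¹ (hd p₀) (tl a) (tl b) (ch-tl c) = ch-tl c
  oldF-child⁻¹ (tl q₀) (hd a) (hd b) (ch-hd c) = ch-hd c
  oldF-child⁻¹ (tl q₀) (tl a) (tl b) (ch-tl c) = ch-tl (oldF-child⁻¹ q₀ a b c)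

  oldF-top⁻¹ : ∀ {xs} (q₀ : PosF xs) (a : PosF xs) → IsTop (oldF q₀ a) → IsTop a
  oldF-top⁻¹ (hd here)     (hd here) _          = top-hd
  oldF-top⁻¹ (hd (down q)) (hd here) _          = top-hd
  oldF-top⁻¹ (hd p₀)       (tl a)    (top-tl t) = top-tl t
  oldF-top⁻¹ (tl q₀)       (hd a)    top-hd     = top-hd
  oldF-top⁻¹ (tl q₀)       (tl a)    (top-tl t) = top-tl (oldF-top⁻¹ q₀ a t)

mutual
  new-child : ∀ {t} (p : Pos t) → Child (old p p) (new p)
  new-child here      = ch-top top-hd
  new-child (down q₀) = ch-down (newF-child q₀)

  newF-child : ∀ {xs} (q₀ : PosF xs) → ChildF (oldF q₀ q₀) (newF q₀)
  newF-child (hd p₀) = ch-hd (new-child p₀)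
  newF-child (tl q₀) = ch-tl (newF-child q₀)

newF-not-top : ∀ {xs} (q₀ : PosF xs) → ¬ IsTop (newF q₀)
newF-not-top (hd here)     ()
newF-not-top (hd (down q)) ()
newF-not-top (tl q₀)       (top-tl t) = newF-not-top q₀ t

mutual
  parent-new : ∀ {t} (p : Pos t) a → Child (old p a) (new p) → a ≡ p
  parent-new here      here     _           = refl
  parent-new here      (down q) (ch-down ())
  parent-new (down q₀) here     (ch-top t)  = ⊥-elim (newF-not-top q₀ t)
  parent-new (down q₀) (down q) (ch-down c) = cong down (parentF-newF q₀ q c)

  parentF-newF : ∀ {xs} (q₀ : PosF xs) a → ChildF (oldF q₀ a) (newF q₀) → a ≡ q₀
  parentF-newF (hd p₀) (hd a) (ch-hd c) = cong hd (parent-new p₀ a c)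
  parentF-newF (hd p₀) (tl a) ()
  parentF-newF (tl q₀) (hd a) ()
  parentF-newF (tl q₀) (tl a) (ch-tl c) = cong tl (parentF-newF q₀ a c)

mutual
  new-childless : ∀ {t} (p : Pos t) a → ¬ Child (new p) (old p a)
  new-childless here      (down q) (ch-down ())
  new-childless (down q₀) (down q) (ch-down c) = newF-childless q₀ q c

  newF-childless : ∀ {xs} (q₀ : PosF xs) a → ¬ ChildF (newF q₀) (oldF q₀ a)
  newF-childless (hd p₀) (hd a) (ch-hd c) = new-childless p₀ a c
  newF-childless (tl q₀) (tl a) (ch-tl c) = newF-childless q₀ a c

module _ {t : Rose} (p : Pos t) where
  private
    G = addLeaf (roseGraph t) p

  join-colour : ∀ z → Graph.colour G z ≡ colour (join p z)
  join-colour (inj₁ a) = sym (old-colour p a)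
  join-colour (inj₂ _) = sym (new-colour p)

  join-adj⁻¹ : ∀ z z' → Adj (join p z) (join p z') → Graph.Edge G z z'
  join-adj⁻¹ (inj₁ a) (inj₁ b) (inj₁ c) = inj₁ (old-child⁻¹ p a b c)
  join-adj⁻¹ (inj₁ a) (inj₁ b) (inj₂ c) = inj₂ (old-child⁻¹ p b a c)
  join-adj⁻¹ (inj₁ a) (inj₂ _) (inj₁ c) = parent-new p a c
  join-adj⁻¹ (inj₁ a) (inj₂ _) (inj₂ c) = ⊥-elim (new-childless p a c)
  join-adj⁻¹ (inj₂ _) (inj₁ b) (inj₁ c) = ⊥-elim (new-childless p b c)
  join-adj⁻¹ (inj₂ _) (inj₁ b) (inj₂ c) = parent-new p b c
  join-adj⁻¹ (inj₂ _) (inj₂ _) a        = adj-colour a refl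

  join-adj : ∀ z z' → Graph.Edge G z z' → Adj (join p z) (join p z')
  join-adj (inj₁ a) (inj₁ b) (inj₁ c) = inj₁ (old-child p c)
  join-adj (inj₁ a) (inj₁ b) (inj₂ c) = inj₂ (old-child p c)
  join-adj (inj₁ a) (inj₂ _) refl     = inj₁ (new-child p)
  join-adj (inj₂ _) (inj₁ b) refl     = inj₂ (new-child p)

  graftLeaf-≃ : roseGraph (graftLeaf t p) ≃ addLeaf (roseGraph t) p
  graftLeaf-≃ = record
    { to = classify p ; from = join p
    ; to-from = λ { (inj₁ a) → classify-old p a ; (inj₂ tt) → classify-new p }
    ; from-to = join-classify p
    ; to-colour = λ x → trans (join-colour (classify p x)) (cong colour (join-classify p x))
    ; to-edge = λ {x} {y} e → join-adj⁻¹ (classify p x) (classify p y)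
                  (subst₂ Adj (sym (join-classify p x)) (sym (join-classify p y)) e)
    ; from-edge = λ {z} {z'} → join-adj z z' }

freeTreeGraph : ∀ {n} → BicFreeTree n → Graph
freeTreeGraph {n} F = record
  { Vertex = Fin n ; colour = BicFreeTree.col F ; Edge = λ x y → BicFreeTree.edge F x y ≡ true }

no-loop : ∀ {n} (F : BicFreeTree n) x → BicFreeTree.edge F x x ≢ true
no-loop F x h with trans (sym h) (BicFreeTree.irrefl F x)
... | ()

last∈ : ∀ {n} (z : Fin n) zs → last z zs ∈ (z ∷ zs)
last∈ z []        = here refl
last∈ z (z' ∷ zs) = there (last∈ z' zs)

-- On a cycle every vertex has two distinct neighbours, a leaf has only one.
module _ {n : ℕ} (E : Fin n → Fin n → Bool) (E-sym : ∀ x y → E x y ≡ E y x)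
         (ℓ c : Fin n) (only-c : ∀ y → E ℓ y ≡ true → y ≡ c) where

  private
    only-c′ : ∀ y → E y ℓ ≡ true → y ≡ c
    only-c′ y e = only-c y (trans (E-sym ℓ y) e)

    on-walk⇒last : ∀ a b rest → Consecutive E (a ∷ b ∷ rest) → Unique (a ∷ b ∷ rest) →
                   ℓ ∈ (b ∷ rest) → ℓ ≡ last b rest
    on-walk⇒last a b []         _               _                   (here e)    = e
    on-walk⇒last a b (d ∷ rest) (eab , ebd , _) ((_ ∷ a≢d ∷ _) ∷ _) (here refl) =
      ⊥-elim (a≢d (trans (only-c′ a eab) (sym (only-c d ebd))))
    on-walk⇒last a b (d ∷ rest) (_ , cons)      (_ ∷ u)             (there m)   =
      on-walk⇒last b d rest cons u m

    penultimate : ∀ y z zs → Consecutive E (y ∷ z ∷ zs) →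
                  ∃ λ w → w ∈ (y ∷ z ∷ zs) × E w (last z zs) ≡ true
    penultimate y z []        (e , _)    = y , here refl , e
    penultimate y z (z' ∷ zs) (_ , cons) with penultimate z z' zs cons
    ... | w , m , e = w , there m , e

  leaf-not-on-cycle : ∀ cs → ℓ ∈ cs → ¬ IsCycle E cs
  leaf-not-on-cycle (x ∷ y ∷ z ∷ zs) (here refl) (((_ ∷ _) ∷ (y≢ ∷ _)) , (exy , _) , close) =
    All.lookup y≢ (last∈ z zs) (trans (only-c y exy) (sym (only-c′ (last z zs) close)))
  leaf-not-on-cycle (x ∷ y ∷ z ∷ zs) (there m) ((x≢ ∷ u) , (exy , cons) , close)
    with on-walk⇒last x y (z ∷ zs) (exy , cons) (x≢ ∷ u) m
  ... | ℓ≡last with penultimate y z zs cons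
  ... | w , w∈ , ew = All.lookup x≢ w∈
        (trans (only-c x (subst (λ v → E v x ≡ true) (sym ℓ≡last) close))
               (sym (only-c′ w (subst (λ v → E w v ≡ true) (sym ℓ≡last) ew))))

module _ {m n : ℕ} (E : Fin n → Fin n → Bool) (f : Fin m → Fin n) where
  private
    E∘f : Fin m → Fin m → Bool
    E∘f a b = E (f a) (f b)

    last-map : ∀ z zs → last (f z) (map f zs) ≡ f (last z zs)
    last-map z []        = refl
    last-map z (z' ∷ zs) = last-map z' zs

    Consecutive-map⁺ : ∀ cs → Consecutive E∘f cs → Consecutive E (map f cs)
    Consecutive-map⁺ []           _       = tt
    Consecutive-map⁺ (x ∷ [])     _       = tt
    Consecutive-map⁺ (x ∷ y ∷ cs) (e , r) = e , Consecutive-map⁺ (y ∷ cs) r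

    Consecutive-map⁻ : ∀ cs → Consecutive E (map f cs) → Consecutive E∘f cs
    Consecutive-map⁻ []           _       = tt
    Consecutive-map⁻ (x ∷ [])     _       = tt
    Consecutive-map⁻ (x ∷ y ∷ cs) (e , r) = e , Consecutive-map⁻ (y ∷ cs) r

  IsCycle-map⁺ : (∀ {a b} → f a ≡ f b → a ≡ b) → ∀ cs → IsCycle E∘f cs → IsCycle E (map f cs)
  IsCycle-map⁺ f-inj (x ∷ y ∷ z ∷ zs) (u , cons , close) =
    Unique.map⁺ f-inj u , Consecutive-map⁺ (x ∷ y ∷ z ∷ zs) cons ,
    subst (λ v → E v (f x) ≡ true) (sym (last-map z zs)) close

  IsCycle-map⁻ : ∀ cs → IsCycle E (map f cs) → IsCycle E∘f cs
  IsCycle-map⁻ (x ∷ y ∷ z ∷ zs) (u , cons , close) =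
    Unique.map⁻ u , Consecutive-map⁻ (x ∷ y ∷ z ∷ zs) cons ,
    subst (λ v → E v (f x) ≡ true) (last-map z zs) close

_==_ : ∀ {n} → Fin n → Fin n → Bool
a == b = does (a ≟ b)

==-refl : ∀ {n} (a : Fin n) → (a == a) ≡ true
==-refl a = dec-true (a ≟ a) refl

==⇒≡ : ∀ {n} {a b : Fin n} → (a == b) ≡ true → a ≡ b
==⇒≡ {a = a} {b} e with a ≟ b
... | yes a≡b = a≡b
==⇒≡ () | no _

∉zero⇒map-suc : ∀ {n} (cs : List (Fin (suc n))) → zero ∉ cs → ∃ λ cs′ → cs ≡ map suc cs′
∉zero⇒map-suc []           _ = [] , refl
∉zero⇒map-suc (zero ∷ cs)  h = ⊥-elim (h (here refl))
∉zero⇒map-suc (suc x ∷ cs) h with ∉zero⇒map-suc cs (λ m → h (there m))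
... | cs′ , e = x ∷ cs′ , cong (suc x ∷_) e

-- The new leaf is the vertex zero, attached to suc c.
module Extend {n : ℕ} (F : BicFreeTree (suc n)) (c : Fin (suc n)) where
  open BicFreeTree F renaming (sym to edge-sym)
  open import Data.List.Membership.DecPropositional (_≟_ {suc (suc n)}) using (_∈?_)

  edge⁺ : Fin (suc (suc n)) → Fin (suc (suc n)) → Bool
  edge⁺ zero    zero    = false
  edge⁺ zero    (suc j) = j == c
  edge⁺ (suc i) zero    = i == c
  edge⁺ (suc i) (suc j) = edge i j

  col⁺ : Fin (suc (suc n)) → Color
  col⁺ zero    = opposite (col c)
  col⁺ (suc i) = col i

  sym⁺ : ∀ x y → edge⁺ x y ≡ edge⁺ y x
  sym⁺ zero    zero    = refl
  sym⁺ zero    (suc j) = refl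
  sym⁺ (suc i) zero    = refl
  sym⁺ (suc i) (suc j) = edge-sym i j

  irrefl⁺ : ∀ x → edge⁺ x x ≡ false
  irrefl⁺ zero    = refl
  irrefl⁺ (suc i) = irrefl i

  lift-path : ∀ {a b} → Star (λ x y → edge x y ≡ true) a b →
              Star (λ x y → edge⁺ x y ≡ true) (suc a) (suc b)
  lift-path = Star.gmap suc (λ e → e)

  connected⁺ : ∀ x y → Star (λ a b → edge⁺ a b ≡ true) x y
  connected⁺ zero    zero    = ε
  connected⁺ zero    (suc j) = ==-refl c ◅ lift-path (connected c j)
  connected⁺ (suc i) zero    = lift-path (connected i c) ◅◅ (==-refl c ◅ ε)
  connected⁺ (suc i) (suc j) = lift-path (connected i j)

  only-suc-c : ∀ y → edge⁺ zero y ≡ true → y ≡ suc c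
  only-suc-c (suc j) e = cong suc (==⇒≡ e)

  acyclic⁺ : ∀ cs → ¬ IsCycle edge⁺ cs
  acyclic⁺ cs cyc with zero ∈? cs
  ... | yes zero∈cs = leaf-not-on-cycle edge⁺ sym⁺ zero (suc c) only-suc-c cs zero∈cs cyc
  ... | no zero∉cs with ∉zero⇒map-suc cs zero∉cs
  ... | cs′ , refl = acyclic cs′ (IsCycle-map⁻ edge⁺ suc cs′ cyc)

  bipartite⁺ : ∀ x y → edge⁺ x y ≡ true → col⁺ x ≢ col⁺ y
  bipartite⁺ zero    (suc j) e with ==⇒≡ {a = j} {c} e
  ... | refl = λ eq → c≢opposite-c (col j) (sym eq)
  bipartite⁺ (suc i) zero    e with ==⇒≡ {a = i} {c} e
  ... | refl = c≢opposite-c (col i)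
  bipartite⁺ (suc i) (suc j) e = bipartite i j e

  tree : BicFreeTree (suc (suc n))
  tree = record
    { edge = edge⁺ ; col = col⁺ ; sym = sym⁺ ; irrefl = irrefl⁺ ; connected = connected⁺
    ; acyclic = acyclic⁺ ; bipartite = bipartite⁺ }

  tree-≃ : freeTreeGraph tree ≃ addLeaf (freeTreeGraph F) c
  tree-≃ = record
    { to = λ { zero → inj₂ tt ; (suc i) → inj₁ i }
    ; from = λ { (inj₁ i) → suc i ; (inj₂ _) → zero }
    ; to-from = λ { (inj₁ i) → refl ; (inj₂ tt) → refl }
    ; from-to = λ { zero → refl ; (suc i) → refl }
    ; to-colour = λ { zero → refl ; (suc i) → refl }
    ; to-edge = λ { {zero} {zero} () ; {zero} {suc j} e → ==⇒≡ e ; {suc i} {zero} e → ==⇒≡ e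
                  ; {suc i} {suc j} e → e }
    ; from-edge = λ { {inj₁ i} {inj₁ j} e → e ; {inj₁ i} {inj₂ _} refl → ==-refl c
                    ; {inj₂ _} {inj₁ j} refl → ==-refl c ; {inj₂ _} {inj₂ _} () } }

Unique⇒length≤ : ∀ {k} (xs : List (Fin k)) → Unique xs → length xs ≤ k
Unique⇒length≤ {k} xs u with length xs ≤? k
... | yes xs≤k = xs≤k
... | no xs≰k with pigeonhole (≰⇒> xs≰k) (lookup xs)
... | i , j , i<j , e = ⊥-elim (distinct u i j i<j e)
  where
  distinct : ∀ {ys : List (Fin k)} → Unique ys → (i j : Fin (length ys)) → i < j →
             lookup ys i ≢ lookup ys j
  distinct (y≢ ∷ u) zero    (suc j) _       = All.lookup y≢ (∈-lookup j)
  distinct (_ ∷ u)  (suc i) (suc j) (s≤s p) = distinct u i j p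

module _ {A : Set} where
  upToHead : ∀ {y : A} {xs} → y ∈ xs → A
  upToHead (here {x = x} _)  = x
  upToHead (there {x = x} _) = x

  upToTail : ∀ {y : A} {xs} → y ∈ xs → List A
  upToTail (here _)  = []
  upToTail (there m) = upToHead m ∷ upToTail m

  -- The prefix of xs ending at the occurrence m of y.
  upTo : ∀ {y : A} {xs} → y ∈ xs → List A
  upTo m = upToHead m ∷ upToTail m

  All-upTo : ∀ {P : A → Set} {y xs} (m : y ∈ xs) → All P xs → All P (upTo m)
  All-upTo (here _)  (px ∷ _)  = px ∷ []
  All-upTo (there m) (px ∷ ps) = px ∷ All-upTo m ps

  Unique-upTo : ∀ {y xs} (m : y ∈ xs) → Unique xs → Unique (upTo m)
  Unique-upTo (here _)  (_ ∷ _)   = [] ∷ []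
  Unique-upTo (there m) (px ∷ u) = All-upTo m px ∷ Unique-upTo m u

last-upTo : ∀ {n} {y : Fin n} {xs} (m : y ∈ xs) → last (upToHead m) (upToTail m) ≡ y
last-upTo (here refl) = refl
last-upTo (there m)   = last-upTo m

Consecutive-upTo : ∀ {n} (E : Fin n → Fin n → Bool) {y} b xs (m : y ∈ xs) →
                   Consecutive E (b ∷ xs) → Consecutive E (b ∷ upTo m)
Consecutive-upTo E b (x ∷ xs) (here refl) (e , _) = e , tt
Consecutive-upTo E b (x ∷ xs) (there m)   (e , c) = e , Consecutive-upTo E x xs m c

record Leaf {n : ℕ} (F : BicFreeTree n) : Set where
  constructor leaf
  field
    vertex neighbour : Fin n
    edge             : BicFreeTree.edge F vertex neighbour ≡ true
    only-neighbour   : ∀ y → BicFreeTree.edge F vertex y ≡ true → y ≡ neighbour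

-- Extend a path (most recent vertex first) while its end has a neighbour off the path. This stops since
-- the path has distinct vertices, and the end it stops at is a leaf: any other neighbour on the path
-- would close a cycle.
module _ {n : ℕ} (F : BicFreeTree (suc (suc n))) where
  private
    N : ℕ
    N = suc (suc n)
  open BicFreeTree F renaming (edge to e; sym to e-sym)
  open import Data.List.Membership.DecPropositional (_≟_ {N}) using (_∈?_)

  private
    some-neighbour : ∀ v → ∃ λ w → e v w ≡ true
    some-neighbour v = first-step (connected v (other v)) (λ eq → other≢ v (sym eq))
      where
      other : Fin N → Fin N
      other zero    = suc zero
      other (suc _) = zero

      other≢ : ∀ v → other v ≢ v
      other≢ zero    ()
      other≢ (suc _) ()

      first-step : ∀ {x y} → Star (λ a b → e a b ≡ true) x y → x ≢ y → ∃ λ w → e x w ≡ true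
      first-step ε                 x≢y = ⊥-elim (x≢y refl)
      first-step (_◅_ {j = w} h _) _   = w , h

    fresh? : ∀ v P w → Dec (e v w ≡ true × w ∉ P)
    fresh? v P w = (e v w Bool.≟ true) ×-dec ¬? (w ∈? P)

    stuck⇒leaf : ∀ v u rest → Unique (v ∷ u ∷ rest) → Consecutive e (v ∷ u ∷ rest) →
                 (∀ y → e v y ≡ true → y ∈ (v ∷ u ∷ rest)) → ∀ y → e v y ≡ true → y ≡ u
    stuck⇒leaf v u rest uniq cons stuck y ey with stuck y ey
    ... | here refl         = ⊥-elim (no-loop F v ey)
    ... | there (here y≡u)  = y≡u
    ... | there (there y∈)  = ⊥-elim (acyclic (v ∷ u ∷ upTo y∈) cycle)
      where
      unique : Unique (v ∷ u ∷ rest) → Unique (v ∷ u ∷ upTo y∈)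
      unique ((v≢u ∷ v≢) ∷ (u≢ ∷ u-rest)) =
        (v≢u ∷ All-upTo y∈ v≢) ∷ (All-upTo y∈ u≢ ∷ Unique-upTo y∈ u-rest)
      cycle : IsCycle e (v ∷ u ∷ upTo y∈)
      cycle = unique uniq , (proj₁ cons , Consecutive-upTo e u rest y∈ (proj₂ cons)) ,
              subst (λ z → e z v ≡ true) (sym (last-upTo y∈)) (trans (e-sym y v) ey)

    walk : (fuel : ℕ) (v : Fin N) (rest : List (Fin N)) → Unique (v ∷ rest) → Consecutive e (v ∷ rest) →
           N ≤ length (v ∷ rest) + fuel → Leaf F
    walk fuel v rest uniq cons bound with any? (fresh? v (v ∷ rest))
    walk zero v rest uniq cons bound | yes (w , _ , w∉) =
      ⊥-elim (n≮n _ (≤-trans (Unique⇒length≤ (w ∷ v ∷ rest) (¬Any⇒All¬ (v ∷ rest) w∉ ∷ uniq))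
                             (subst (N ≤_) (+-identityʳ _) bound)))
    walk (suc fuel) v rest uniq cons bound | yes (w , ew , w∉) =
      walk fuel w (v ∷ rest) (¬Any⇒All¬ (v ∷ rest) w∉ ∷ uniq) (trans (e-sym w v) ew , cons)
           (subst (N ≤_) (+-suc (length (v ∷ rest)) fuel) bound)
    walk fuel v [] uniq cons bound | no none with some-neighbour v
    ... | w , ew with w ∈? (v ∷ [])
    ... | yes (here refl) = ⊥-elim (no-loop F v ew)
    ... | no w∉           = ⊥-elim (none (w , ew , w∉))
    walk fuel v (u ∷ rest) uniq cons bound | no none =
      leaf v u (proj₁ cons) (stuck⇒leaf v u rest uniq cons stuck)
      where
      stuck : ∀ y → e v y ≡ true → y ∈ (v ∷ u ∷ rest)
      stuck y ey with y ∈? (v ∷ u ∷ rest)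
      ... | yes y∈ = y∈
      ... | no y∉  = ⊥-elim (none (y , ey , y∉))

  leaf-exists : Leaf F
  leaf-exists = walk N zero [] ([] ∷ []) tt (n≤1+n N)

module Prune {n : ℕ} (F : BicFreeTree (suc (suc n))) {ℓ c : Fin (suc (suc n))}
             (ℓ-c : BicFreeTree.edge F ℓ c ≡ true)
             (only-neighbour : ∀ y → BicFreeTree.edge F ℓ y ≡ true → y ≡ c) where
  open BicFreeTree F renaming (edge to e; col to cl; sym to e-sym)

  private
    Edge : Fin (suc (suc n)) → Fin (suc (suc n)) → Set
    Edge a b = e a b ≡ true

    ℓ≢c : ℓ ≢ c
    ℓ≢c ℓ≡c = no-loop F ℓ (subst (λ z → e ℓ z ≡ true) (sym ℓ≡c) ℓ-c)

    only-c′ : ∀ y → e y ℓ ≡ true → y ≡ c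
    only-c′ y h = only-neighbour y (trans (e-sym ℓ y) h)

  c′ : Fin (suc n)
  c′ = punchOut ℓ≢c

  c′-colour : cl (punchIn ℓ c′) ≡ cl c
  c′-colour = cong cl (punchIn-punchOut ℓ≢c)

  edge′ : Fin (suc n) → Fin (suc n) → Bool
  edge′ a b = e (punchIn ℓ a) (punchIn ℓ b)

  -- A path between vertices other than ℓ avoids ℓ, up to shortcutting the detour c ℓ c.
  path′ : ∀ {x y} → Star Edge x y → ∀ a b → punchIn ℓ a ≡ x → punchIn ℓ b ≡ y →
          Star (λ a b → edge′ a b ≡ true) a b
  path′ ε a b ea eb with punchIn-injective ℓ a b (trans ea (sym eb))
  ... | refl = ε
  path′ (_◅_ {j = w} h s) a b ea eb with ℓ ≟ w
  ... | no ℓ≢w = subst₂ Edge (sym ea) (sym (punchIn-punchOut ℓ≢w)) h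
                 ◅ path′ s (punchOut ℓ≢w) b (punchIn-punchOut ℓ≢w) eb
  path′ (_◅_ {j = .ℓ} h ε) a b ea eb | yes refl = ⊥-elim (punchInᵢ≢i ℓ b eb)
  path′ (_◅_ {i = x} {j = .ℓ} h (_◅_ {j = v} h′ s)) a b ea eb | yes refl =
    path′ s a b (trans ea (trans (only-c′ x h) (sym (only-neighbour v h′)))) eb

  tree : BicFreeTree (suc n)
  tree = record
    { edge = edge′ ; col = λ a → cl (punchIn ℓ a) ; sym = λ a b → e-sym _ _ ; irrefl = λ a → irrefl _
    ; connected = λ a b → path′ (connected (punchIn ℓ a) (punchIn ℓ b)) a b refl refl
    ; acyclic = λ cs cyc → acyclic (map (punchIn ℓ) cs)
                  (IsCycle-map⁺ e (punchIn ℓ) (λ {a} {b} → punchIn-injective ℓ a b) cs cyc)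
    ; bipartite = λ a b h → bipartite _ _ h }

  private
    G = addLeaf (freeTreeGraph tree) c′

    toG : Fin (suc (suc n)) → Fin (suc n) ⊎ ⊤
    toG x with ℓ ≟ x
    ... | yes _   = inj₂ tt
    ... | no ℓ≢x = inj₁ (punchOut ℓ≢x)

    fromG : Fin (suc n) ⊎ ⊤ → Fin (suc (suc n))
    fromG (inj₁ a) = punchIn ℓ a
    fromG (inj₂ _) = ℓ

    toG-fromG : ∀ z → toG (fromG z) ≡ z
    toG-fromG (inj₁ a) with ℓ ≟ punchIn ℓ a
    ... | yes ℓ≡ = ⊥-elim (punchInᵢ≢i ℓ a (sym ℓ≡))
    ... | no _   = cong inj₁ (trans (punchOut-cong ℓ refl) (punchOut-punchIn ℓ))
    toG-fromG (inj₂ tt) with ℓ ≟ ℓ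
    ... | yes _  = refl
    ... | no ℓ≢ℓ = ⊥-elim (ℓ≢ℓ refl)

    fromG-toG : ∀ x → fromG (toG x) ≡ x
    fromG-toG x with ℓ ≟ x
    ... | yes refl = refl
    ... | no ℓ≢x  = punchIn-punchOut ℓ≢x

    toG-colour : ∀ x → Graph.colour G (toG x) ≡ cl x
    toG-colour x with ℓ ≟ x
    ... | yes refl = trans (cong opposite c′-colour) (sym (≢⇒≡opposite (bipartite ℓ c ℓ-c)))
    ... | no ℓ≢x  = cong cl (punchIn-punchOut ℓ≢x)

    toG-edge : ∀ {x y} → Edge x y → Graph.Edge G (toG x) (toG y)
    toG-edge {x} {y} h with ℓ ≟ x | ℓ ≟ y
    ... | yes refl | yes refl = ⊥-elim (ℓ≢c (only-neighbour ℓ h))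
    ... | yes refl | no _     = punchOut-cong ℓ (only-neighbour y h)
    ... | no _     | yes refl = punchOut-cong ℓ (only-c′ x h)
    ... | no ℓ≢x  | no ℓ≢y  =
      subst₂ Edge (sym (punchIn-punchOut ℓ≢x)) (sym (punchIn-punchOut ℓ≢y)) h

    fromG-edge : ∀ {z z′} → Graph.Edge G z z′ → Edge (fromG z) (fromG z′)
    fromG-edge {inj₁ a} {inj₁ b} h    = h
    fromG-edge {inj₁ a} {inj₂ _} refl =
      trans (cong (λ z → e z ℓ) (punchIn-punchOut ℓ≢c)) (trans (e-sym c ℓ) ℓ-c)
    fromG-edge {inj₂ _} {inj₁ b} refl = trans (cong (e ℓ) (punchIn-punchOut ℓ≢c)) ℓ-c

  tree-≃ : freeTreeGraph F ≃ addLeaf (freeTreeGraph tree) c′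
  tree-≃ = record
    { to = toG ; from = fromG ; to-from = toG-fromG ; from-to = fromG-toG
    ; to-colour = toG-colour ; to-edge = toG-edge ; from-edge = λ {z} {z′} → fromG-edge {z} {z′} }

decompose : ∀ (x : Rose) (xs : List Rose) → ∃ λ t → ∃ λ (p : Pos t) → rose (x ∷ xs) ≡ graftLeaf t p
decompose (rose [])       xs = rose xs , here , refl
decompose (rose (y ∷ ys)) xs with decompose y ys
... | t , p , e = rose (t ∷ xs) , down (hd p) , cong (λ z → rose (z ∷ xs)) e

singleton : BicFreeTree 1
singleton = record
  { edge = λ _ _ → false ; col = λ _ → white ; sym = λ _ _ → refl ; irrefl = λ _ → refl
  ; connected = λ { zero zero → ε }
  ; acyclic = λ { (x ∷ y ∷ z ∷ zs) (_ , (() , _) , _) }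
  ; bipartite = λ _ _ () }

white-singleton-≃ : (F : BicFreeTree 1) (v : Fin 1) → BicFreeTree.col F v ≡ white →
                    roseGraph (rose []) ≃ freeTreeGraph F
white-singleton-≃ F zero isWhite = record
  { to = λ _ → zero ; from = λ _ → here
  ; to-from = λ { zero → refl } ; from-to = λ { here → refl }
  ; to-colour = λ { here → isWhite }
  ; to-edge = λ { {here} {here} (inj₁ ()) ; {here} {here} (inj₂ ()) }
  ; from-edge = λ { {zero} {zero} e → ⊥-elim (no-loop F zero e) } }

graftLeaf-≃-extend : ∀ {n t} {F : BicFreeTree (suc n)} (φ : roseGraph t ≃ freeTreeGraph F) (p : Pos t) →
                     roseGraph (graftLeaf t p) ≃ freeTreeGraph (Extend.tree F (to φ p))
graftLeaf-≃-extend {F = F} φ p =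
  ≃-trans (graftLeaf-≃ p) (≃-trans (addLeaf-cong φ p) (≃-sym (Extend.tree-≃ F (to φ p))))

rose⇒freeTree : ∀ n (t : Rose) → order t ≡ suc n →
                Σ (BicFreeTree (suc n)) λ F → roseGraph t ≃ freeTreeGraph F
rose⇒freeTree zero    (rose [])           refl = singleton , white-singleton-≃ singleton zero refl
rose⇒freeTree zero    (rose (rose _ ∷ _)) ()
rose⇒freeTree (suc n) (rose [])           ()
rose⇒freeTree (suc n) (rose (x ∷ xs))     order≡ with decompose x xs
... | t , p , t≡
  with rose⇒freeTree n t
         (suc-injective (trans (sym (order-graftLeaf t p)) (trans (cong order (sym t≡)) order≡)))
... | F , φ = Extend.tree F (to φ p) ,
  subst (λ u → roseGraph u ≃ freeTreeGraph (Extend.tree F (to φ p))) (sym t≡) (graftLeaf-≃-extend φ p)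

regraft : ∀ {n} (F : BicFreeTree (suc (suc n))) {ℓ c} (ℓ-c : BicFreeTree.edge F ℓ c ≡ true)
          (only : ∀ y → BicFreeTree.edge F ℓ y ≡ true → y ≡ c) {t : Rose} →
          order t ≡ suc n → roseGraph t ≃ freeTreeGraph (Prune.tree F ℓ-c only) →
          Σ Rose λ t′ → order t′ ≡ suc (suc n) × roseGraph t′ ≃ freeTreeGraph F
regraft F ℓ-c only {t} order≡ φ =
  graftLeaf t p , trans (order-graftLeaf t p) (cong suc order≡) ,
  ≃-trans (graftLeaf-≃ p) (≃-trans addLeaf-≃ (≃-sym (Prune.tree-≃ F ℓ-c only)))
  where
  c′ = Prune.c′ F ℓ-c only
  p  = from φ c′
  addLeaf-≃ : addLeaf (roseGraph t) p ≃ addLeaf _ c′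
  addLeaf-≃ = subst (λ v → addLeaf (roseGraph t) p ≃ addLeaf _ v) (to-from φ c′) (addLeaf-cong φ p)

module _ (F : BicFreeTree 2) where
  open BicFreeTree F renaming (edge to e; sym to e-sym)

  private
    adjacent : e zero (suc zero) ≡ true
    adjacent with connected zero (suc zero)
    ... | _◅_ {j = zero}     h _ = ⊥-elim (no-loop F zero h)
    ... | _◅_ {j = suc zero} h _ = h

    adjacent′ : e (suc zero) zero ≡ true
    adjacent′ = trans (e-sym _ _) adjacent

    only₀ : ∀ y → e zero y ≡ true → y ≡ suc zero
    only₀ zero       h = ⊥-elim (no-loop F zero h)
    only₀ (suc zero) _ = refl

    only₁ : ∀ y → e (suc zero) y ≡ true → y ≡ zero
    only₁ zero       _ = refl
    only₁ (suc zero) h = ⊥-elim (no-loop F (suc zero) h)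

    regraft-white : ∀ {ℓ c} (ℓ-c : e ℓ c ≡ true) (only : ∀ y → e ℓ y ≡ true → y ≡ c) →
                    col c ≡ white → Σ Rose λ t → order t ≡ 2 × roseGraph t ≃ freeTreeGraph F
    regraft-white ℓ-c only c-white = regraft F ℓ-c only refl
      (white-singleton-≃ (Prune.tree F ℓ-c only) (Prune.c′ F ℓ-c only)
                         (trans (Prune.c′-colour F ℓ-c only) c-white))

  -- Prune the black vertex, so that what remains is white like the root of rose [].
  two-vertex : Σ Rose λ t → order t ≡ 2 × roseGraph t ≃ freeTreeGraph F
  two-vertex with col (suc zero) in col₁
  ... | white = regraft-white adjacent only₀ col₁
  ... | black = regraft-white adjacent′ only₁
                  (trans (≢⇒≡opposite (bipartite zero (suc zero) adjacent)) (cong opposite col₁))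

freeTree⇒rose : ∀ n (F : BicFreeTree (suc (suc n))) →
                Σ Rose λ t → order t ≡ suc (suc n) × roseGraph t ≃ freeTreeGraph F
freeTree⇒rose zero    F = two-vertex F
freeTree⇒rose (suc n) F with leaf-exists F
... | leaf ℓ c ℓ-c only with freeTree⇒rose n (Prune.tree F ℓ-c only)
... | t , order≡ , φ = regraft F ℓ-c only order≡ φ

mutual
  orderF-whiteForest : ∀ T → orderF (whiteForest T) ≡ size T
  orderF-whiteForest leaf       = refl
  orderF-whiteForest (node A B) =
    cong suc (trans (cong₂ _+_ (orderF-blackForest B) (orderF-whiteForest A)) (+-comm (size B) (size A)))

  orderF-blackForest : ∀ T → orderF (blackForest T) ≡ size T
  orderF-blackForest leaf       = refl
  orderF-blackForest (node A B) = cong suc (cong₂ _+_ (orderF-whiteForest A) (orderF-blackForest B))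

ψ≅freeTree : ∀ A B → Σ (BicFreeTree (suc (size (node A B)))) λ F → ψ (node A B) ≅ toBGraph F
ψ≅freeTree A B with rose⇒freeTree _ _ (cong suc (orderF-whiteForest (node A B)))
... | F , φ = F , ≅-trans ψ≅whiteTree (≃⇒≅ φ)

freeTree≅ψ : ∀ n (F : BicFreeTree (suc (suc n))) → Σ BT λ T → size T ≡ suc n × ψ T ≅ toBGraph F
freeTree≅ψ n F with freeTree⇒rose n F
... | rose (rose f ∷ g) , order≡ , φ = ofWhiteForest xs , size≡ , ≅-trans ψ≅whiteTree (≃⇒≅ φ′)
  where
  xs = rose f ∷ g

  forest≡ : whiteForest (ofWhiteForest xs) ≡ xs
  forest≡ = whiteForest-ofWhiteForest xs

  size≡ : size (ofWhiteForest xs) ≡ suc n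
  size≡ = trans (sym (orderF-whiteForest (ofWhiteForest xs)))
                (trans (cong orderF forest≡) (suc-injective order≡))

  φ′ : roseGraph (rose (whiteForest (ofWhiteForest xs))) ≃ freeTreeGraph F
  φ′ = subst (λ ys → roseGraph (rose ys) ≃ freeTreeGraph F) (sym forest≡) φ

mainTheorem14 : (m : ℕ) → 1 ≤ m →
    ((T T' : BT) → size T ≡ m → size T' ≡ m → (LREquiv T T' ⇔ (ψ T ≅ ψ T')))
    × ((T : BT) → size T ≡ m → Σ (BicFreeTree (suc m)) (λ F → ψ T ≅ toBGraph F))
    × ((F : BicFreeTree (suc m)) → Σ BT (λ T → size T ≡ m × (ψ T ≅ toBGraph F)))
mainTheorem14 (suc n) _ = classes , encode , freeTree≅ψ n
  where
  classes : (T T' : BT) → size T ≡ suc n → size T' ≡ suc n → LREquiv T T' ⇔ (ψ T ≅ ψ T')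
  classes (node _ _) (node _ _) _ _ = LREquiv⇔ψ≅
  classes leaf       _          () _
  classes (node _ _) leaf       _ ()

  encode : (T : BT) → size T ≡ suc n → Σ (BicFreeTree (suc (suc n))) λ F → ψ T ≅ toBGraph F
  encode (node A B) refl = ψ≅freeTree A B
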